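{- Let $\mathbf{I}_{\mathsf P}\subseteq\mathbf{W}$ be the subspace spanned by all differences $[v,m]-[w,n]$ of basis elements with $\operatorname{fl}(v)=\operatorname{fl}(w)$. Then $\mathbf{I}_{\mathsf P}$ is a homogeneous bi-ideal (a two-sided ideal and a coideal) of the bialgebra $(\mathbf{W},\nabla_{\mathrm{sh}},\iota,\Delta_\odot,\epsilon_\odot)$, and the quotient bialgebra $\mathbf{W}/\mathbf{I}_{\mathsf P}$ is a graded Hopf algebra.
   Context: Fix a field $\mathbb{k}$. A word is a finite sequence of positive integers; $\max(w)$ is its largest letter ($\max(\emptyset)=0$) and $\ell(w)$ its length. For a word $w=w_1\cdots w_k$ whose set of letters $S$ has $r$ elements, $\operatorname{fl}(w)=\phi(w_1)\cdots\phi(w_k)$ where $\phi:S\to\{1,\dots,r\}$ is the order-preserving bijection. For words $u$ (length $a$), $v$ (length $b$), $\operatorname{sh}(u,v)=\sum_{I\subseteq\{1,\dots,a+b\},|I|=a}x_I$ (with multiplicity), $x_I$ being the word whose letters at positions in $I$ spell $u$ and elsewhere spell $v$; $w\uparrow m$ adds $m$ to each letter. $\mathbf{W}$ is the graded $\mathbb{k}$-vector space with basis the symbols $[w,n]$ ($n\in\mathbb{N}$, $w$ a word with $\max(w)\le n$), $[w,n]$ of degree $\ell(w)$, with product $\nabla_{\mathrm{sh}}([v,m]\otimes[w,n])=\sum_{u\in\operatorname{sh}(v,w\uparrow m)}[u,m+n]$, unit $[\emptyset,0]$, coproduct $\Delta_\odot([w_1\cdots w_k,n])=\sum_{i=0}^k[w_1\cdots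 w_i,n]\otimes[w_{i+1}\cdots w_k,n]$, and counit $\epsilon_\odot([w,n])=1$ if $w=\emptyset$, $0$ otherwise; this is a graded bialgebra. -}

module Defs where

open import Level using (Level; _⊔_; suc)
open import Algebra.Bundles using (CommutativeRing)
open import Data.Nat as ℕ using (ℕ; zero; _≤?_)
open import Data.Fin as Fin using (Fin; toℕ; _↑ˡ_; _↑ʳ_)
open import Data.List as List using (List; []; _∷_; _++_; map; concatMap; filter; length; take; drop; deduplicate; applyUpTo; foldr)
open import Data.List.Properties using (≡-dec)
open import Data.Product using (Σ; Σ-syntax; ∃; ∃-syntax; _×_; _,_; proj₁; proj₂)
open import Data.Product.Properties as ×P using ()
open import Relation.Nullary using (¬_; Dec; yes; no)
open import Relation.Binary.Definitions using (DecidableEquality)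
open import Relation.Binary.PropositionalEquality using (_≡_; refl; cong)

record Field (c ℓ : Level) : Set (Level.suc (c ⊔ ℓ)) where
  field
    commutativeRing : CommutativeRing c ℓ
  open CommutativeRing commutativeRing public
  field
    0≉1     : ¬ (0# ≈ 1#)
    inverse : ∀ x → ¬ (x ≈ 0#) → ∃[ y ] (x * y ≈ 1#)

-- A word with letters in the positive integers is encoded, when all its
-- letters are ≤ n, as a list over Fin n: the letter i : Fin n stands for
-- the positive integer toℕ i + 1.  With this encoding, w ↑ m is
-- map (raise m) w.

letters : ∀ {n} → List (Fin n) → List ℕ
letters = map (λ i → ℕ.suc (toℕ i))

-- fl on words with positive-integer letters: the order-preserving
-- bijection φ : S → {1..r} sends a letter a to #{ s ∈ S | s ≤ a }.
fl : List ℕ → List ℕ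
fl w = map (λ a → length (filter (_≤? a) (deduplicate ℕ._≟_ w))) w

-- shuffles, with multiplicity (the standard recursion, which enumerates
-- the words x_I for the a-subsets I of {1..a+b}, each exactly once)
sh : ∀ {A : Set} → List A → List A → List (List A)
sh [] v = v ∷ []
sh (a ∷ u) [] = (a ∷ u) ∷ []
sh (a ∷ u) (b ∷ v) = map (a ∷_) (sh u (b ∷ v)) ++ map (b ∷_) (sh (a ∷ u) v)

-- The basis of W: symbols [w , n] with max(w) ≤ n.

Basis : Set
Basis = Σ ℕ (λ n → List (Fin n))

deg : Basis → ℕ
deg (n , w) = length w

flB : Basis → List ℕ
flB (n , w) = fl (letters w)

_≟B_ : DecidableEquality Basis
(m , v) ≟B (n , w) with m ℕ.≟ n
... | no ne = no (λ eq → ne (cong proj₁ eq))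
... | yes refl with ≡-dec Fin._≟_ v w
...   | yes refl = yes refl
...   | no ne = no (λ { refl → ne refl })

_≟B²_ : DecidableEquality (Basis × Basis)
_≟B²_ = ×P.≡-dec _≟B_ _≟B_

-- product of basis elements (a list = formal sum with multiplicity)
shB : Basis → Basis → List Basis
shB (m , v) (n , w) =
  map (λ u → (m ℕ.+ n , u)) (sh (map (_↑ˡ n) v) (map (m ↑ʳ_) w))

ΔB : Basis → List (Basis × Basis)
ΔB (n , w) = applyUpTo (λ i → ((n , take i w) , (n , drop i w))) (ℕ.suc (length w))

module Over {c ℓ} (F : Field c ℓ) where
  open Field F

  -- a vector of the free space on a set X with decidable equality is a
  -- finite formal linear combination; equality is equality of all
  -- coefficients
  Free : Set → Set c
  Free X = List (Carrier × X)

  module _ {X : Set} (_≟_ : DecidableEquality X) where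
    coeff : X → Free X → Carrier
    coeff x [] = 0#
    coeff x ((a , y) ∷ t) with x ≟ y
    ... | yes _ = a + coeff x t
    ... | no _  = coeff x t

    _≈F_ : Free X → Free X → Set ℓ
    u ≈F v = ∀ x → coeff x u ≈ coeff x v

  infixl 6 _⊕_ _⊖_
  _⊕_ : ∀ {X} → Free X → Free X → Free X
  _⊕_ = _++_

  _·_ : ∀ {X} → Carrier → Free X → Free X
  a · u = map (λ { (b , x) → (a * b , x) }) u

  _⊖_ : ∀ {X} → Free X → Free X → Free X
  u ⊖ v = u ⊕ ((- 1#) · v)

  ⟦_⟧ : ∀ {X} → X → Free X
  ⟦ x ⟧ = (1# , x) ∷ []

  lin : ∀ {X Y} → (X → Free Y) → Free X → Free Y
  lin f u = concatMap (λ { (a , x) → a · f x }) u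

  bilin : ∀ {X Y Z} → (X → Y → Free Z) → Free X → Free Y → Free Z
  bilin f u v = lin (λ x → lin (λ y → f x y) v) u

  W : Set c
  W = Free Basis

  _≈W_ : W → W → Set ℓ
  _≈W_ = _≈F_ _≟B_

  W⊗W : Set c
  W⊗W = Free (Basis × Basis)

  _≈T_ : W⊗W → W⊗W → Set ℓ
  _≈T_ = _≈F_ _≟B²_

  _∙_ : W → W → W
  _∙_ = bilin (λ x y → map (λ u → (1# , u)) (shB x y))

  𝟙 : W
  𝟙 = ⟦ (0 , []) ⟧

  Δ : W → W⊗W
  Δ = lin (λ x → map (λ p → (1# , p)) (ΔB x))

  εB : Basis → Carrier
  εB (n , []) = 1#
  εB (n , _ ∷ _) = 0#

  ε : W → Carrier
  ε u = foldr (λ { (a , x) r → a * εB x + r }) 0# u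

  _⊗map_ : (Basis → W) → (Basis → W) → W⊗W → W⊗W
  (f ⊗map g) = lin (λ { (x , y) → bilin (λ x′ y′ → ⟦ (x′ , y′) ⟧) (f x) (g y) })

  mult : W⊗W → W
  mult = lin (λ { (x , y) → ⟦ x ⟧ ∙ ⟦ y ⟧ })

  proj : ℕ → W → W
  proj d = filter (λ { (_ , x) → deg x ℕ.≟ d })

  Gen : Set
  Gen = Σ (Basis × Basis) (λ { (x , y) → flB x ≡ flB y })

  genVec : Gen → W
  genVec ((x , y) , _) = ⟦ x ⟧ ⊖ ⟦ y ⟧

  InI : W → Set (c ⊔ ℓ)
  InI u = Σ[ gs ∈ Free Gen ] (u ≈W lin genVec gs)

  InI⊗W+W⊗I : W⊗W → Set (c ⊔ ℓ)
  InI⊗W+W⊗I t =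
    Σ[ ls ∈ Free (Gen × Basis) ] Σ[ rs ∈ Free (Basis × Gen) ]
      (t ≈T (lin (λ { (g , y) → bilin (λ x′ y′ → ⟦ (x′ , y′) ⟧) (genVec g) ⟦ y ⟧ }) ls
            ⊕ lin (λ { (x , g) → bilin (λ x′ y′ → ⟦ (x′ , y′) ⟧) ⟦ x ⟧ (genVec g) }) rs))

  IsTwoSidedIdeal : Set (c ⊔ ℓ)
  IsTwoSidedIdeal = ∀ u v → InI u → InI (u ∙ v) × InI (v ∙ u)

  IsCoideal : Set (c ⊔ ℓ)
  IsCoideal = ∀ u → InI u → InI⊗W+W⊗I (Δ u) × (ε u ≈ 0#)

  IsHomogeneous : Set (c ⊔ ℓ)
  IsHomogeneous = ∀ u → InI u → ∀ d → InI (proj d u)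

  -- The quotient bialgebra W / I_P (well defined since I_P is a bi-ideal)
  -- has an antipode: a linear map S (given on the basis, extended
  -- linearly), preserving degrees and I_P, with
  --   ∇ ∘ (S ⊗ id) ∘ Δ = ι ∘ ε = ∇ ∘ (id ⊗ S) ∘ Δ   modulo I_P.
  -- By linearity it suffices to check these on basis elements.
  QuotientHasGradedAntipode : Set (c ⊔ ℓ)
  QuotientHasGradedAntipode =
    Σ[ S ∈ (Basis → W) ]
      ((∀ x → proj (deg x) (S x) ≈W S x)
      × (∀ u → InI u → InI (lin S u))
      × (∀ x → InI (mult ((S ⊗map ⟦_⟧) (Δ ⟦ x ⟧)) ⊖ (εB x · 𝟙)))
      × (∀ x → InI (mult ((⟦_⟧ ⊗map S) (Δ ⟦ x ⟧)) ⊖ (εB x · 𝟙))))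

module Submission where

-- A pattern records only the relative order of the letters, hence it is
-- kept by prefixes and suffixes (Δ_⊙ deconcatenates: coideal), by shuffles of two words whose letters lie
-- in disjoint ranges, the second above the first (the product shifts its second factor: ideal), and it
-- has the length of the word (homogeneity, ε_⊙(I_P) = 0). Modulo I_P the product is associative, since
-- shuffling is, with unit [∅,k], since shifting keeps patterns; so maps from the basis to W form a monoid
-- under convolution. The antipode S is defined by the recursion ∇(S ⊗ id)Δ = ιε. The map S′ defined by
-- ∇(id ⊗ S′)Δ = ιε agrees with S modulo I_P, a left and a right inverse of id in that monoid, and S
-- preserves degrees and I_P because its recursion only involves prefixes and suffixes.

open import Defs
open import Data.Product using (_×_; _,_)

module Lists where

  open import Algebra.Bundles using (CommutativeMonoid)
  import Algebra.Properties.CommutativeSemigroup as CommutativeSemigroupProperties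
  open import Data.Nat using (ℕ; zero; suc; _+_; _≤_; _<_; z≤n; s≤s)
  import Data.Nat.Properties as ℕP
  open import Data.List using (List; []; _∷_; _++_; [_]; map; concatMap; length; take; drop; applyUpTo)
  import Data.List.Properties as ListP
  open import Data.List.Relation.Unary.All using (All; []; _∷_)
  open import Data.List.Relation.Unary.Any using (here; there)
  open import Data.List.Membership.Propositional using (_∈_)
  open import Data.List.Membership.Propositional.Properties using (∈-map⁻; ∈-++⁻; ∈-++⁺ˡ)
  open import Data.List.Relation.Binary.Pointwise using (Pointwise; []; _∷_)
  open import Data.List.Relation.Binary.Permutation.Propositional as Perm
    using (_↭_; ↭-refl; ↭-sym; ↭-trans; ↭-reflexive; prep; swap; module PermutationReasoning)
  import Data.List.Relation.Binary.Permutation.Propositional.Properties as PermP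
  open import Data.Product using (_×_; _,_; proj₁; proj₂; map₁)
  open import Data.Sum as Sum using (_⊎_; inj₁; inj₂)
  open import Function using (_∘_)
  open import Relation.Binary.PropositionalEquality as ≡ using (_≡_; refl; cong; cong₂; sym; trans; subst)

  ++-interchange : ∀ {ℓ} {A : Set ℓ} (a b c d : List A) → (a ++ b) ++ (c ++ d) ↭ (a ++ c) ++ (b ++ d)
  ++-interchange {A = A} = CommutativeSemigroupProperties.interchange
    (CommutativeMonoid.commutativeSemigroup (PermP.++-commutativeMonoid {A = A}))

  concatMap-↭ : ∀ {ℓ} {A : Set ℓ} {B : Set} (f : B → List A) {L L′} →
    L ↭ L′ → concatMap f L ↭ concatMap f L′
  concatMap-↭ f Perm.refl = ↭-refl
  concatMap-↭ f (prep x p) = PermP.++⁺ˡ (f x) (concatMap-↭ f p)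
  concatMap-↭ f (swap x y p) =
    ↭-trans (PermP.shifts (f x) (f y)) (PermP.++⁺ˡ (f y) (PermP.++⁺ˡ (f x) (concatMap-↭ f p)))
  concatMap-↭ f (Perm.trans p q) = ↭-trans (concatMap-↭ f p) (concatMap-↭ f q)

  concatMap-++ᶠ : ∀ {A B : Set} (f g : B → List A) L →
    concatMap (λ t → f t ++ g t) L ↭ concatMap f L ++ concatMap g L
  concatMap-++ᶠ f g [] = ↭-refl
  concatMap-++ᶠ f g (t ∷ L) = ↭-trans (PermP.++⁺ˡ (f t ++ g t) (concatMap-++ᶠ f g L))
    (++-interchange (f t) (g t) (concatMap f L) (concatMap g L))

  module _ {A : Set} where

    open PermutationReasoning

    sh-[]ʳ : ∀ (u : List A) → sh u [] ≡ [ u ]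
    sh-[]ʳ [] = refl
    sh-[]ʳ (x ∷ u) = refl

    ∈-sh⁻ : ∀ u v {z : List A} {x : A} → z ∈ sh u v → x ∈ z → x ∈ u ⊎ x ∈ v
    ∈-sh⁻ [] v (here refl) x∈ = inj₂ x∈
    ∈-sh⁻ (a ∷ u) [] (here refl) x∈ = inj₁ x∈
    ∈-sh⁻ (a ∷ u) (b ∷ v) z∈ x∈ with ∈-++⁻ (map (a ∷_) (sh u (b ∷ v))) z∈
    ... | inj₁ z∈ˡ with ∈-map⁻ (a ∷_) z∈ˡ
    ...   | z , z∈′ , refl with x∈
    ...     | here e = inj₁ (here e)
    ...     | there x∈z = Sum.map₁ there (∈-sh⁻ u (b ∷ v) z∈′ x∈z)
    ∈-sh⁻ (a ∷ u) (b ∷ v) z∈ x∈ | inj₂ z∈ʳ with ∈-map⁻ (b ∷_) z∈ʳ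
    ...   | z , z∈′ , refl with x∈
    ...     | here e = inj₂ (here e)
    ...     | there x∈z = Sum.map₂ there (∈-sh⁻ (a ∷ u) v z∈′ x∈z)

    length-sh : ∀ u v {z : List A} → z ∈ sh u v → length z ≡ length u + length v
    length-sh [] v (here refl) = refl
    length-sh (a ∷ u) [] (here refl) = cong suc (sym (ℕP.+-identityʳ (length u)))
    length-sh (a ∷ u) (b ∷ v) z∈ with ∈-++⁻ (map (a ∷_) (sh u (b ∷ v))) z∈
    ... | inj₁ z∈ˡ with ∈-map⁻ (a ∷_) z∈ˡ
    ...   | z , z∈′ , refl = cong suc (length-sh u (b ∷ v) z∈′)
    length-sh (a ∷ u) (b ∷ v) z∈ | inj₂ z∈ʳ with ∈-map⁻ (b ∷_) z∈ʳ
    ...   | z , z∈′ , refl =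
      trans (cong suc (length-sh (a ∷ u) v z∈′)) (sym (ℕP.+-suc (suc (length u)) (length v)))

    sh₃ : List A → List A → List A → List (List A)
    sh₃ [] v w = sh v w
    sh₃ (a ∷ u) [] w = sh (a ∷ u) w
    sh₃ (a ∷ u) (b ∷ v) [] = sh (a ∷ u) (b ∷ v)
    sh₃ (a ∷ u) (b ∷ v) (c ∷ w) =
      map (a ∷_) (sh₃ u (b ∷ v) (c ∷ w)) ++
      map (b ∷_) (sh₃ (a ∷ u) v (c ∷ w)) ++
      map (c ∷_) (sh₃ (a ∷ u) (b ∷ v) w)

    private
      concatMap-cons² : ∀ {B : Set} a b (f g : B → List (List A)) L →
        concatMap (λ t → map (a ∷_) (f t) ++ map (b ∷_) (g t)) L
          ↭ map (a ∷_) (concatMap f L) ++ map (b ∷_) (concatMap g L)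
      concatMap-cons² a b f g L = begin
        concatMap (λ t → map (a ∷_) (f t) ++ map (b ∷_) (g t)) L
          ↭⟨ concatMap-++ᶠ (map (a ∷_) ∘ f) (map (b ∷_) ∘ g) L ⟩
        concatMap (map (a ∷_) ∘ f) L ++ concatMap (map (b ∷_) ∘ g) L
          ≡⟨ sym (cong₂ _++_ (ListP.map-concatMap (a ∷_) f L) (ListP.map-concatMap (b ∷_) g L)) ⟩
        map (a ∷_) (concatMap f L) ++ map (b ∷_) (concatMap g L) ∎

    sh-shˡ : List A → List A → List A → List (List A)
    sh-shˡ u v w = concatMap (λ t → sh t w) (sh u v)

    sh-shʳ : List A → List A → List A → List (List A)
    sh-shʳ u v w = concatMap (sh u) (sh v w)

    private
      sh-shˡ-step : ∀ a c w L → concatMap (λ t → sh t (c ∷ w)) (map (a ∷_) L)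
        ↭ map (a ∷_) (concatMap (λ t → sh t (c ∷ w)) L) ++ map (c ∷_) (concatMap (λ t → sh t w) (map (a ∷_) L))
      sh-shˡ-step a c w L = begin
        concatMap (λ t → sh t (c ∷ w)) (map (a ∷_) L)
          ≡⟨ ListP.concatMap-map (λ t → sh t (c ∷ w)) (a ∷_) L ⟩
        concatMap (λ t → map (a ∷_) (sh t (c ∷ w)) ++ map (c ∷_) (sh (a ∷ t) w)) L
          ↭⟨ concatMap-cons² a c (λ t → sh t (c ∷ w)) (λ t → sh (a ∷ t) w) L ⟩
        map (a ∷_) X ++ map (c ∷_) (concatMap (λ t → sh (a ∷ t) w) L)
          ≡⟨ cong (λ Y → map (a ∷_) X ++ map (c ∷_) Y) (sym (ListP.concatMap-map (λ t → sh t w) (a ∷_) L)) ⟩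
        map (a ∷_) X ++ map (c ∷_) (concatMap (λ t → sh t w) (map (a ∷_) L)) ∎
        where X = concatMap (λ t → sh t (c ∷ w)) L

      sh-shʳ-step : ∀ a u b L → concatMap (sh (a ∷ u)) (map (b ∷_) L)
        ↭ map (a ∷_) (concatMap (sh u) (map (b ∷_) L)) ++ map (b ∷_) (concatMap (sh (a ∷ u)) L)
      sh-shʳ-step a u b L = begin
        concatMap (sh (a ∷ u)) (map (b ∷_) L)
          ≡⟨ ListP.concatMap-map (sh (a ∷ u)) (b ∷_) L ⟩
        concatMap (λ t → map (a ∷_) (sh u (b ∷ t)) ++ map (b ∷_) (sh (a ∷ u) t)) L
          ↭⟨ concatMap-cons² a b (λ t → sh u (b ∷ t)) (sh (a ∷ u)) L ⟩
        map (a ∷_) (concatMap (λ t → sh u (b ∷ t)) L) ++ map (b ∷_) (concatMap (sh (a ∷ u)) L)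
          ≡⟨ cong (λ X → map (a ∷_) X ++ map (b ∷_) (concatMap (sh (a ∷ u)) L))
               (sym (ListP.concatMap-map (sh u) (b ∷_) L)) ⟩
        map (a ∷_) (concatMap (sh u) (map (b ∷_) L)) ++ map (b ∷_) (concatMap (sh (a ∷ u)) L) ∎

    sh-shˡ↭sh₃ : ∀ u v w → sh-shˡ u v w ↭ sh₃ u v w
    sh-shˡ↭sh₃ [] v w = ↭-reflexive (ListP.++-identityʳ (sh v w))
    sh-shˡ↭sh₃ (a ∷ u) [] w = ↭-reflexive (ListP.++-identityʳ (sh (a ∷ u) w))
    sh-shˡ↭sh₃ (a ∷ u) (b ∷ v) [] = ↭-reflexive
      (trans (ListP.concatMap-cong sh-[]ʳ (sh (a ∷ u) (b ∷ v))) (ListP.concatMap-pure (sh (a ∷ u) (b ∷ v))))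
    sh-shˡ↭sh₃ (a ∷ u) (b ∷ v) (c ∷ w) = begin
      concatMap (λ t → sh t (c ∷ w)) (map (a ∷_) L₁ ++ map (b ∷_) L₂)
        ≡⟨ ListP.concatMap-++ (λ t → sh t (c ∷ w)) (map (a ∷_) L₁) (map (b ∷_) L₂) ⟩
      concatMap (λ t → sh t (c ∷ w)) (map (a ∷_) L₁) ++ concatMap (λ t → sh t (c ∷ w)) (map (b ∷_) L₂)
        ↭⟨ PermP.++⁺ (sh-shˡ-step a c w L₁) (sh-shˡ-step b c w L₂) ⟩
      (map (a ∷_) X ++ map (c ∷_) R₁) ++ (map (b ∷_) Y ++ map (c ∷_) R₂)
        ↭⟨ ++-interchange (map (a ∷_) X) (map (c ∷_) R₁) (map (b ∷_) Y) (map (c ∷_) R₂) ⟩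
      (map (a ∷_) X ++ map (b ∷_) Y) ++ (map (c ∷_) R₁ ++ map (c ∷_) R₂)
        ≡⟨ cong ((map (a ∷_) X ++ map (b ∷_) Y) ++_) (trans (sym (ListP.map-++ (c ∷_) R₁ R₂))
             (cong (map (c ∷_)) (sym (ListP.concatMap-++ (λ t → sh t w) (map (a ∷_) L₁) (map (b ∷_) L₂))))) ⟩
      (map (a ∷_) X ++ map (b ∷_) Y) ++ map (c ∷_) Z
        ↭⟨ PermP.++⁺ (PermP.++⁺ (PermP.map⁺ (a ∷_) (sh-shˡ↭sh₃ u (b ∷ v) (c ∷ w)))
                                (PermP.map⁺ (b ∷_) (sh-shˡ↭sh₃ (a ∷ u) v (c ∷ w))))
                     (PermP.map⁺ (c ∷_) (sh-shˡ↭sh₃ (a ∷ u) (b ∷ v) w)) ⟩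
      (map (a ∷_) (sh₃ u (b ∷ v) (c ∷ w)) ++ map (b ∷_) (sh₃ (a ∷ u) v (c ∷ w)))
        ++ map (c ∷_) (sh₃ (a ∷ u) (b ∷ v) w)
        ≡⟨ ListP.++-assoc (map (a ∷_) (sh₃ u (b ∷ v) (c ∷ w))) _ _ ⟩
      sh₃ (a ∷ u) (b ∷ v) (c ∷ w) ∎
      where
      L₁ = sh u (b ∷ v)
      L₂ = sh (a ∷ u) v
      R₁ = concatMap (λ t → sh t w) (map (a ∷_) L₁)
      R₂ = concatMap (λ t → sh t w) (map (b ∷_) L₂)
      X = sh-shˡ u (b ∷ v) (c ∷ w)
      Y = sh-shˡ (a ∷ u) v (c ∷ w)
      Z = sh-shˡ (a ∷ u) (b ∷ v) w

    sh-shʳ↭sh₃ : ∀ u v w → sh-shʳ u v w ↭ sh₃ u v w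
    sh-shʳ↭sh₃ [] v w = ↭-reflexive (ListP.concatMap-pure (sh v w))
    sh-shʳ↭sh₃ (a ∷ u) [] w = ↭-reflexive (ListP.++-identityʳ (sh (a ∷ u) w))
    sh-shʳ↭sh₃ (a ∷ u) (b ∷ v) [] = ↭-reflexive (ListP.++-identityʳ (sh (a ∷ u) (b ∷ v)))
    sh-shʳ↭sh₃ (a ∷ u) (b ∷ v) (c ∷ w) = begin
      concatMap (sh (a ∷ u)) (map (b ∷_) M₁ ++ map (c ∷_) M₂)
        ≡⟨ ListP.concatMap-++ (sh (a ∷ u)) (map (b ∷_) M₁) (map (c ∷_) M₂) ⟩
      concatMap (sh (a ∷ u)) (map (b ∷_) M₁) ++ concatMap (sh (a ∷ u)) (map (c ∷_) M₂)
        ↭⟨ PermP.++⁺ (sh-shʳ-step a u b M₁) (sh-shʳ-step a u c M₂) ⟩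
      (map (a ∷_) P₁ ++ map (b ∷_) Y) ++ (map (a ∷_) P₂ ++ map (c ∷_) Z)
        ↭⟨ ++-interchange (map (a ∷_) P₁) (map (b ∷_) Y) (map (a ∷_) P₂) (map (c ∷_) Z) ⟩
      (map (a ∷_) P₁ ++ map (a ∷_) P₂) ++ (map (b ∷_) Y ++ map (c ∷_) Z)
        ≡⟨ cong (_++ (map (b ∷_) Y ++ map (c ∷_) Z)) (trans (sym (ListP.map-++ (a ∷_) P₁ P₂))
             (cong (map (a ∷_)) (sym (ListP.concatMap-++ (sh u) (map (b ∷_) M₁) (map (c ∷_) M₂))))) ⟩
      map (a ∷_) X ++ (map (b ∷_) Y ++ map (c ∷_) Z)
        ↭⟨ PermP.++⁺ (PermP.map⁺ (a ∷_) (sh-shʳ↭sh₃ u (b ∷ v) (c ∷ w)))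
                     (PermP.++⁺ (PermP.map⁺ (b ∷_) (sh-shʳ↭sh₃ (a ∷ u) v (c ∷ w)))
                                (PermP.map⁺ (c ∷_) (sh-shʳ↭sh₃ (a ∷ u) (b ∷ v) w))) ⟩
      sh₃ (a ∷ u) (b ∷ v) (c ∷ w) ∎
      where
      M₁ = sh v (c ∷ w)
      M₂ = sh (b ∷ v) w
      P₁ = concatMap (sh u) (map (b ∷_) M₁)
      P₂ = concatMap (sh u) (map (c ∷_) M₂)
      X = sh-shʳ u (b ∷ v) (c ∷ w)
      Y = sh-shʳ (a ∷ u) v (c ∷ w)
      Z = sh-shʳ (a ∷ u) (b ∷ v) w

    sh-assoc : ∀ u v w → sh-shˡ u v w ↭ sh-shʳ u v w
    sh-assoc u v w = ↭-trans (sh-shˡ↭sh₃ u v w) (↭-sym (sh-shʳ↭sh₃ u v w))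

  map-sh : ∀ {A B : Set} (f : A → B) u v → sh (map f u) (map f v) ≡ map (map f) (sh u v)
  map-sh f [] v = refl
  map-sh f (a ∷ u) [] = refl
  map-sh f (a ∷ u) (b ∷ v) = begin
    map (f a ∷_) (sh (map f u) (map f (b ∷ v))) ++ map (f b ∷_) (sh (map f (a ∷ u)) (map f v))
      ≡⟨ cong₂ (λ L M → map (f a ∷_) L ++ map (f b ∷_) M) (map-sh f u (b ∷ v)) (map-sh f (a ∷ u) v) ⟩
    map (f a ∷_) (map (map f) (sh u (b ∷ v))) ++ map (f b ∷_) (map (map f) (sh (a ∷ u) v))
      ≡⟨ cong₂ _++_ (map-cons a (sh u (b ∷ v))) (map-cons b (sh (a ∷ u) v)) ⟩
    map (map f) (map (a ∷_) (sh u (b ∷ v))) ++ map (map f) (map (b ∷_) (sh (a ∷ u) v))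
      ≡⟨ sym (ListP.map-++ (map f) (map (a ∷_) (sh u (b ∷ v))) (map (b ∷_) (sh (a ∷ u) v))) ⟩
    map (map f) (map (a ∷_) (sh u (b ∷ v)) ++ map (b ∷_) (sh (a ∷ u) v)) ∎
    where
    open ≡.≡-Reasoning
    map-cons : ∀ x L → map (f x ∷_) (map (map f) L) ≡ map (map f) (map (x ∷_) L)
    map-cons x L = trans (sym (ListP.map-∘ L)) (ListP.map-∘ L)

  applyUpTo-pointwise : ∀ {A B : Set} {R : A → B → Set} {f : ℕ → A} {g : ℕ → B} k →
    (∀ {i} → i < k → R (f i) (g i)) → Pointwise R (applyUpTo f k) (applyUpTo g k)
  applyUpTo-pointwise zero r = []
  applyUpTo-pointwise (suc k) r = r (s≤s z≤n) ∷ applyUpTo-pointwise k (r ∘ s≤s)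

  map-applyUpTo : ∀ {B C : Set} (g : B → C) (f : ℕ → B) k → map g (applyUpTo f k) ≡ applyUpTo (g ∘ f) k
  map-applyUpTo g f zero = refl
  map-applyUpTo g f (suc k) = cong (g (f 0) ∷_) (map-applyUpTo g (f ∘ suc) k)

  concatMap-concatMap : ∀ {ℓ} {A B : Set} {C : Set ℓ} (f : B → List C) (g : A → List B) L →
    concatMap f (concatMap g L) ≡ concatMap (concatMap f ∘ g) L
  concatMap-concatMap f g [] = refl
  concatMap-concatMap f g (x ∷ L) =
    trans (ListP.concatMap-++ f (g x) (concatMap g L)) (cong (concatMap f (g x) ++_) (concatMap-concatMap f g L))

  concatMap-cong-∈ : ∀ {ℓ} {A : Set} {B : Set ℓ} {f g : A → List B} L →
    (∀ {x} → x ∈ L → f x ≡ g x) → concatMap f L ≡ concatMap g L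
  concatMap-cong-∈ [] f≡g = refl
  concatMap-cong-∈ (x ∷ L) f≡g = cong₂ _++_ (f≡g (here refl)) (concatMap-cong-∈ L (f≡g ∘ there))

  All⇒Pointwise-diagonal : ∀ {A : Set} {R : A → A → Set} {xs} → All (λ x → R x x) xs → Pointwise R xs xs
  All⇒Pointwise-diagonal [] = []
  All⇒Pointwise-diagonal (r ∷ rs) = r ∷ All⇒Pointwise-diagonal rs

  module _ {A : Set} where

    splits : List A → List (List A × List A)
    splits [] = [ ([] , []) ]
    splits (a ∷ w) = ([] , a ∷ w) ∷ map (map₁ (a ∷_)) (splits w)

    initSplits : List A → List (List A × List A)
    initSplits [] = []
    initSplits (a ∷ w) = ([] , a ∷ w) ∷ map (map₁ (a ∷_)) (initSplits w)

    splits≡initSplits∷ʳ : ∀ w → splits w ≡ initSplits w ++ [ (w , []) ]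
    splits≡initSplits∷ʳ [] = refl
    splits≡initSplits∷ʳ (a ∷ w) = cong (([] , a ∷ w) ∷_)
      (trans (cong (map (map₁ (a ∷_))) (splits≡initSplits∷ʳ w)) (ListP.map-++ (map₁ (a ∷_)) (initSplits w) _))

    splits-applyUpTo : ∀ w → splits w ≡ applyUpTo (λ i → take i w , drop i w) (suc (length w))
    splits-applyUpTo [] = refl
    splits-applyUpTo (a ∷ w) = cong (([] , a ∷ w) ∷_)
      (trans (cong (map (map₁ (a ∷_))) (splits-applyUpTo w))
             (map-applyUpTo (map₁ (a ∷_)) (λ i → take i w , drop i w) (suc (length w))))

    initSplits-applyUpTo : ∀ w → initSplits w ≡ applyUpTo (λ i → take i w , drop i w) (length w)
    initSplits-applyUpTo [] = refl
    initSplits-applyUpTo (a ∷ w) = cong (([] , a ∷ w) ∷_)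
      (trans (cong (map (map₁ (a ∷_))) (initSplits-applyUpTo w))
             (map-applyUpTo (map₁ (a ∷_)) (λ i → take i w , drop i w) (length w)))

    ++-∈-splits : ∀ w {pq} → pq ∈ splits w → proj₁ pq ++ proj₂ pq ≡ w
    ++-∈-splits [] (here refl) = refl
    ++-∈-splits (a ∷ w) (here refl) = refl
    ++-∈-splits (a ∷ w) (there pq∈) with ∈-map⁻ (map₁ (a ∷_)) pq∈
    ... | pq , pq∈′ , refl = cong (a ∷_) (++-∈-splits w pq∈′)

    ++-∈-initSplits : ∀ w {pq} → pq ∈ initSplits w → proj₁ pq ++ proj₂ pq ≡ w
    ++-∈-initSplits w pq∈ = ++-∈-splits w (subst (_ ∈_) (sym (splits≡initSplits∷ʳ w)) (∈-++⁺ˡ pq∈))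

    length-proj₁-∈-initSplits : ∀ w {pq} → pq ∈ initSplits w → length (proj₁ pq) < length w
    length-proj₁-∈-initSplits (a ∷ w) (here refl) = s≤s z≤n
    length-proj₁-∈-initSplits (a ∷ w) (there pq∈) with ∈-map⁻ (map₁ (a ∷_)) pq∈
    ... | pq , pq∈′ , refl = s≤s (length-proj₁-∈-initSplits w pq∈′)

    length-proj₂-∈-splits : ∀ w {pq} → pq ∈ splits w → length (proj₂ pq) ≤ length w
    length-proj₂-∈-splits w {pq} pq∈ = subst (length (proj₂ pq) ≤_)
      (trans (sym (ListP.length-++ (proj₁ pq))) (cong length (++-∈-splits w pq∈))) (ℕP.m≤n+m _ _)

    splits₃ˡ splits₃ʳ : List A → List (List A × List A × List A)
    splits₃ˡ w = concatMap (λ ps → map (λ qr → proj₁ ps , proj₁ qr , proj₂ qr) (splits (proj₂ ps))) (splits w)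
    splits₃ʳ w = concatMap (λ tr → map (λ pq → proj₁ pq , proj₂ pq , proj₂ tr) (splits (proj₁ tr))) (splits w)

    private
      consˡ : A → List A × List A × List A → List A × List A × List A
      consˡ a = map₁ (a ∷_)

      consᵐ : A → List A × List A → List A × List A × List A
      consᵐ a tr = [] , a ∷ proj₁ tr , proj₂ tr

      splits₃ˡ-∷ : ∀ a w →
        splits₃ˡ (a ∷ w) ≡ ([] , [] , a ∷ w) ∷ (map (consᵐ a) (splits w) ++ map (consˡ a) (splits₃ˡ w))
      splits₃ˡ-∷ a w = cong (([] , [] , a ∷ w) ∷_) (cong₂ _++_ (sym (ListP.map-∘ (splits w)))
        (trans (ListP.concatMap-map _ (map₁ (a ∷_)) (splits w))
          (sym (trans (ListP.map-concatMap (consˡ a) _ (splits w))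
            (ListP.concatMap-cong (λ ps → sym (ListP.map-∘ (splits (proj₂ ps)))) (splits w))))))

      splits₃ʳ-∷ : ∀ a w →
        splits₃ʳ (a ∷ w) ↭ ([] , [] , a ∷ w) ∷ (map (consᵐ a) (splits w) ++ map (consˡ a) (splits₃ʳ w))
      splits₃ʳ-∷ a w = prep ([] , [] , a ∷ w) (begin
        concatMap G (map (map₁ (a ∷_)) (splits w))
          ≡⟨ ListP.concatMap-map G (map₁ (a ∷_)) (splits w) ⟩
        concatMap (G ∘ map₁ (a ∷_)) (splits w)
          ≡⟨ ListP.concatMap-cong (λ tr → cong (consᵐ a tr ∷_)
               (trans (sym (ListP.map-∘ (splits (proj₁ tr)))) (ListP.map-∘ (splits (proj₁ tr))))) (splits w) ⟩
        concatMap (λ tr → [ consᵐ a tr ] ++ map (consˡ a) (G tr)) (splits w)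
          ↭⟨ concatMap-++ᶠ (λ tr → [ consᵐ a tr ]) (map (consˡ a) ∘ G) (splits w) ⟩
        concatMap (λ tr → [ consᵐ a tr ]) (splits w) ++ concatMap (map (consˡ a) ∘ G) (splits w)
          ≡⟨ cong₂ _++_ (trans (sym (ListP.concatMap-map [_] (consᵐ a) (splits w)))
                               (ListP.concatMap-pure (map (consᵐ a) (splits w))))
                        (sym (ListP.map-concatMap (consˡ a) G (splits w))) ⟩
        map (consᵐ a) (splits w) ++ map (consˡ a) (splits₃ʳ w) ∎)
        where
        open PermutationReasoning
        G : List A × List A → List (List A × List A × List A)
        G tr = map (λ pq → (proj₁ pq , proj₂ pq , proj₂ tr)) (splits (proj₁ tr))

    splits₃ˡ↭splits₃ʳ : ∀ w → splits₃ˡ w ↭ splits₃ʳ w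
    splits₃ˡ↭splits₃ʳ [] = ↭-refl
    splits₃ˡ↭splits₃ʳ (a ∷ w) = ↭-trans (↭-reflexive (splits₃ˡ-∷ a w))
      (↭-trans (prep _ (PermP.++⁺ˡ _ (PermP.map⁺ (consˡ a) (splits₃ˡ↭splits₃ʳ w))))
               (↭-sym (splits₃ʳ-∷ a w)))

module Flattening where

  import Level
  open import Data.Nat as ℕ using (ℕ; _+_; _≤_; _<_; _≤?_; s≤s)
  import Data.Nat.Properties as ℕP
  open import Data.List using (List; []; _∷_; map; filter; deduplicate; length; take; drop; zip)
  import Data.List.Properties as ListP
  open import Data.List.Relation.Unary.All as All using (All; []; _∷_)
  import Data.List.Relation.Unary.All.Properties as All
  open import Data.List.Relation.Unary.Any using (here; there)
  open import Data.List.Membership.Propositional using (_∈_)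
  open import Data.List.Membership.Propositional.Properties using (∈-map⁺; ∈-map⁻; ∈-deduplicate⁺; ∈-filter⁻)
  open import Data.List.Relation.Binary.Pointwise as Pointwise using (Pointwise)
  open import Data.List.Relation.Binary.Sublist.Propositional using (⊆-refl; lookup)
  open import Data.List.Relation.Binary.Sublist.Heterogeneous.Properties
    using (length-mono-≤; ⊆-filter-Sublist; take-Sublist; drop-Sublist)
  open import Data.Product as Product using (Σ-syntax; _×_; _,_; proj₁; proj₂)
  open import Data.Sum using (inj₁; inj₂)
  open import Data.Empty using (⊥-elim)
  open import Function using (_∘_)
  open import Relation.Nullary using (¬_; yes; no; ¬?)
  open import Relation.Unary using (Pred; Decidable)
  open import Relation.Binary.PropositionalEquality as ≡ using (_≡_; refl; cong; sym; trans; subst; subst₂)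
  open Lists using (∈-sh⁻; map-sh; All⇒Pointwise-diagonal)

  rank : List ℕ → ℕ → ℕ
  rank w a = length (filter (_≤? a) (deduplicate ℕ._≟_ w))

  private
    length-filter-mono : ∀ {P Q : Pred ℕ Level.zero} (P? : Decidable P) (Q? : Decidable Q) →
      (∀ {x} → P x → Q x) → ∀ xs → length (filter P? xs) ≤ length (filter Q? xs)
    length-filter-mono P? Q? P⇒Q xs =
      length-mono-≤ (⊆-filter-Sublist P? Q? (λ { refl → P⇒Q }) (⊆-refl {x = xs}))

    length-filter-mono-< : ∀ {P Q : Pred ℕ Level.zero} (P? : Decidable P) (Q? : Decidable Q) →
      (∀ {x} → P x → Q x) → ∀ xs {y} → y ∈ xs → ¬ P y → Q y →
      length (filter P? xs) < length (filter Q? xs)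
    length-filter-mono-< P? Q? P⇒Q (x ∷ xs) (here refl) ¬py qy with P? x | Q? x
    ... | yes px | _ = ⊥-elim (¬py px)
    ... | no _ | yes _ = s≤s (length-filter-mono P? Q? P⇒Q xs)
    ... | no _ | no ¬qy = ⊥-elim (¬qy qy)
    length-filter-mono-< P? Q? P⇒Q (x ∷ xs) (there y∈) ¬py qy with P? x | Q? x
    ... | yes _ | yes _ = s≤s (length-filter-mono-< P? Q? P⇒Q xs y∈ ¬py qy)
    ... | yes px | no ¬qx = ⊥-elim (¬qx (P⇒Q px))
    ... | no _ | yes _ = ℕP.m≤n⇒m≤1+n (length-filter-mono-< P? Q? P⇒Q xs y∈ ¬py qy)
    ... | no _ | no _ = length-filter-mono-< P? Q? P⇒Q xs y∈ ¬py qy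

  rank-mono : ∀ w {a b} → a ≤ b → rank w a ≤ rank w b
  rank-mono w a≤b =
    length-filter-mono (_≤? _) (_≤? _) (λ x≤a → ℕP.≤-trans x≤a a≤b) (deduplicate ℕ._≟_ w)

  rank-reflects-≤ : ∀ w {a b} → a ∈ w → rank w a ≤ rank w b → a ≤ b
  rank-reflects-≤ w {a} {b} a∈w ra≤rb with a ≤? b
  ... | yes a≤b = a≤b
  ... | no a≰b = ⊥-elim (ℕP.<⇒≱ (length-filter-mono-< (_≤? b) (_≤? a)
                   (λ x≤b → ℕP.≤-trans x≤b (ℕP.<⇒≤ (ℕP.≰⇒> a≰b))) (deduplicate ℕ._≟_ w)
                   (∈-deduplicate⁺ ℕ._≟_ a∈w) a≰b ℕP.≤-refl) ra≤rb)

  -- fl a ≡ fl b says exactly that the positions of a and b are ordered alike; we record this through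
  -- the list of pairs of corresponding letters, which must form an order isomorphism.
  OrderIso : List (ℕ × ℕ) → Set
  OrderIso ps = ∀ {p q} → p ∈ ps → q ∈ ps →
    (proj₁ p ≤ proj₁ q → proj₂ p ≤ proj₂ q) × (proj₂ p ≤ proj₂ q → proj₁ p ≤ proj₁ q)

  Similar : List ℕ → List ℕ → Set
  Similar a b = Σ[ ps ∈ List (ℕ × ℕ) ] map proj₁ ps ≡ a × map proj₂ ps ≡ b × OrderIso ps

  OrderIso-⊆ : ∀ {ps qs} → (∀ {p} → p ∈ qs → p ∈ ps) → OrderIso ps → OrderIso qs
  OrderIso-⊆ qs⊆ps iso p∈ q∈ = iso (qs⊆ps p∈) (qs⊆ps q∈)

  OrderIso-≡ : ∀ {ps} → OrderIso ps → ∀ {p q} → p ∈ ps → q ∈ ps →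
    (proj₁ p ≡ proj₁ q → proj₂ p ≡ proj₂ q) × (proj₂ p ≡ proj₂ q → proj₁ p ≡ proj₁ q)
  OrderIso-≡ iso p∈ q∈ =
    (λ e → ≤-antisym (proj₁ (iso p∈ q∈) (≤-reflexive e)) (proj₁ (iso q∈ p∈) (≤-reflexive (sym e)))) ,
    (λ e → ≤-antisym (proj₂ (iso p∈ q∈) (≤-reflexive e)) (proj₂ (iso q∈ p∈) (≤-reflexive (sym e))))
    where open ℕP using (≤-antisym; ≤-reflexive)

  private
    filter-map : ∀ {A B : Set} {P : Pred B Level.zero} (P? : Decidable P) (f : A → B) xs →
      filter P? (map f xs) ≡ map f (filter (P? ∘ f) xs)
    filter-map P? f [] = refl
    filter-map P? f (x ∷ xs) with P? (f x)
    ... | yes _ = cong (f x ∷_) (filter-map P? f xs)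
    ... | no _ = filter-map P? f xs

    filter-cong-local : ∀ {A : Set} {P Q : Pred A Level.zero} (P? : Decidable P) (Q? : Decidable Q) xs →
      All (λ x → (P x → Q x) × (Q x → P x)) xs → filter P? xs ≡ filter Q? xs
    filter-cong-local P? Q? [] [] = refl
    filter-cong-local P? Q? (x ∷ xs) ((p⇒q , q⇒p) ∷ rest) with P? x | Q? x
    ... | yes _ | yes _ = cong (x ∷_) (filter-cong-local P? Q? xs rest)
    ... | yes px | no ¬qx = ⊥-elim (¬qx (p⇒q px))
    ... | no ¬px | yes qx = ⊥-elim (¬px (q⇒p qx))
    ... | no _ | no _ = filter-cong-local P? Q? xs rest

    -- Within an order isomorphism, equal first coordinates go with equal second coordinates, so
    -- deduplicating both coordinate lists can be done by one common sublist of pairs.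
    deduplicate-unzip : ∀ ps₀ → OrderIso ps₀ → ∀ ps → (∀ {p} → p ∈ ps → p ∈ ps₀) →
      Σ[ qs ∈ List (ℕ × ℕ) ] (∀ {q} → q ∈ qs → q ∈ ps₀)
        × deduplicate ℕ._≟_ (map proj₁ ps) ≡ map proj₁ qs
        × deduplicate ℕ._≟_ (map proj₂ ps) ≡ map proj₂ qs
    deduplicate-unzip ps₀ iso [] _ = [] , (λ ()) , refl , refl
    deduplicate-unzip ps₀ iso (p ∷ ps) ps⊆ with deduplicate-unzip ps₀ iso ps (ps⊆ ∘ there)
    ... | qs , qs⊆ , e₁ , e₂ =
      p ∷ filter Fresh₁ qs , qs′⊆ ,
      cong (proj₁ p ∷_) (trans (cong (filter _) e₁) (filter-map _ proj₁ qs)) ,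
      cong (proj₂ p ∷_) (trans (cong (filter _) e₂)
                                (trans (filter-map _ proj₂ qs) (cong (map proj₂) (sym fresh₁≡fresh₂))))
      where
      Fresh₁ : Decidable (λ (q : ℕ × ℕ) → ¬ proj₁ p ≡ proj₁ q)
      Fresh₁ q = ¬? (proj₁ p ℕ.≟ proj₁ q)
      Fresh₂ : Decidable (λ (q : ℕ × ℕ) → ¬ proj₂ p ≡ proj₂ q)
      Fresh₂ q = ¬? (proj₂ p ℕ.≟ proj₂ q)
      qs′⊆ : ∀ {q} → q ∈ p ∷ filter Fresh₁ qs → q ∈ ps₀
      qs′⊆ (here refl) = ps⊆ (here refl)
      qs′⊆ (there q∈) = qs⊆ (proj₁ (∈-filter⁻ Fresh₁ {xs = qs} q∈))
      fresh₁≡fresh₂ : filter Fresh₁ qs ≡ filter Fresh₂ qs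
      fresh₁≡fresh₂ = filter-cong-local Fresh₁ Fresh₂ qs (All.tabulate (λ q∈ →
        (λ ne e → ne (proj₂ (OrderIso-≡ iso (ps⊆ (here refl)) (qs⊆ q∈)) e)) ,
        (λ ne e → ne (proj₁ (OrderIso-≡ iso (ps⊆ (here refl)) (qs⊆ q∈)) e))))

  rank-OrderIso : ∀ ps → OrderIso ps → ∀ {p} → p ∈ ps →
    rank (map proj₁ ps) (proj₁ p) ≡ rank (map proj₂ ps) (proj₂ p)
  rank-OrderIso ps iso {p} p∈ with deduplicate-unzip ps iso ps (λ q∈ → q∈)
  ... | qs , qs⊆ , e₁ , e₂ = begin
    length (filter (_≤? proj₁ p) (deduplicate ℕ._≟_ (map proj₁ ps)))
      ≡⟨ cong (length ∘ filter (_≤? proj₁ p)) e₁ ⟩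
    length (filter (_≤? proj₁ p) (map proj₁ qs))
      ≡⟨ cong length (filter-map (_≤? proj₁ p) proj₁ qs) ⟩
    length (map proj₁ (filter (λ q → proj₁ q ≤? proj₁ p) qs))
      ≡⟨ ListP.length-map proj₁ (filter (λ q → proj₁ q ≤? proj₁ p) qs) ⟩
    length (filter (λ q → proj₁ q ≤? proj₁ p) qs)
      ≡⟨ cong length (filter-cong-local _ _ qs (All.tabulate (λ q∈ → iso (qs⊆ q∈) p∈))) ⟩
    length (filter (λ q → proj₂ q ≤? proj₂ p) qs)
      ≡⟨ sym (ListP.length-map proj₂ (filter (λ q → proj₂ q ≤? proj₂ p) qs)) ⟩
    length (map proj₂ (filter (λ q → proj₂ q ≤? proj₂ p) qs))
      ≡⟨ cong length (sym (filter-map (_≤? proj₂ p) proj₂ qs)) ⟩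
    length (filter (_≤? proj₂ p) (map proj₂ qs))
      ≡⟨ cong (length ∘ filter (_≤? proj₂ p)) (sym e₂) ⟩
    length (filter (_≤? proj₂ p) (deduplicate ℕ._≟_ (map proj₂ ps))) ∎
    where open ≡.≡-Reasoning

  Similar⇒fl≡ : ∀ {a b} → Similar a b → fl a ≡ fl b
  Similar⇒fl≡ (ps , refl , refl , iso) = begin
    map (rank (map proj₁ ps)) (map proj₁ ps) ≡⟨ sym (ListP.map-∘ ps) ⟩
    map (λ p → rank (map proj₁ ps) (proj₁ p)) ps ≡⟨ ListP.map-cong-local (All.tabulate (rank-OrderIso ps iso)) ⟩
    map (λ p → rank (map proj₂ ps) (proj₂ p)) ps ≡⟨ ListP.map-∘ ps ⟩
    map (rank (map proj₂ ps)) (map proj₂ ps) ∎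
    where open ≡.≡-Reasoning

  private
    module _ (f g : ℕ → ℕ) where
      map-proj₁-zip : ∀ a b → map f a ≡ map g b → map proj₁ (zip a b) ≡ a
      map-proj₁-zip [] [] e = refl
      map-proj₁-zip (x ∷ a) (y ∷ b) e = cong (x ∷_) (map-proj₁-zip a b (ListP.∷-injectiveʳ e))

      map-proj₂-zip : ∀ a b → map f a ≡ map g b → map proj₂ (zip a b) ≡ b
      map-proj₂-zip [] [] e = refl
      map-proj₂-zip (x ∷ a) (y ∷ b) e = cong (y ∷_) (map-proj₂-zip a b (ListP.∷-injectiveʳ e))

      ∈-zip-related : ∀ a b → map f a ≡ map g b → ∀ {p} → p ∈ zip a b → f (proj₁ p) ≡ g (proj₂ p)
      ∈-zip-related (x ∷ a) (y ∷ b) e (here refl) = ListP.∷-injectiveˡ e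
      ∈-zip-related (x ∷ a) (y ∷ b) e (there p∈) = ∈-zip-related a b (ListP.∷-injectiveʳ e) p∈

  fl≡⇒Similar : ∀ a b → fl a ≡ fl b → Similar a b
  fl≡⇒Similar a b e = zip a b , proj₁≡a , proj₂≡b , iso
    where
    proj₁≡a = map-proj₁-zip (rank a) (rank b) a b e
    proj₂≡b = map-proj₂-zip (rank a) (rank b) a b e
    related = ∈-zip-related (rank a) (rank b) a b e
    ∈a : ∀ {p} → p ∈ zip a b → proj₁ p ∈ a
    ∈a p∈ = subst (_ ∈_) proj₁≡a (∈-map⁺ proj₁ p∈)
    ∈b : ∀ {p} → p ∈ zip a b → proj₂ p ∈ b
    ∈b p∈ = subst (_ ∈_) proj₂≡b (∈-map⁺ proj₂ p∈)
    iso : OrderIso (zip a b)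
    iso p∈ q∈ =
      (λ ≤₁ → rank-reflects-≤ b (∈b p∈) (subst₂ _≤_ (related p∈) (related q∈) (rank-mono a ≤₁))) ,
      (λ ≤₂ → rank-reflects-≤ a (∈a p∈)
                (subst₂ _≤_ (sym (related p∈)) (sym (related q∈)) (rank-mono b ≤₂)))

  Similar-take : ∀ i {a b} → Similar a b → Similar (take i a) (take i b)
  Similar-take i (ps , refl , refl , iso) =
    take i ps , sym (ListP.take-map i ps) , sym (ListP.take-map i ps) ,
    OrderIso-⊆ (lookup (take-Sublist i ⊆-refl)) iso

  Similar-drop : ∀ i {a b} → Similar a b → Similar (drop i a) (drop i b)
  Similar-drop i (ps , refl , refl , iso) =
    drop i ps , sym (ListP.drop-map i ps) , sym (ListP.drop-map i ps) ,
    OrderIso-⊆ (lookup (drop-Sublist i ⊆-refl)) iso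

  Similar-shift : ∀ m m′ {a b} → Similar a b → Similar (map (m +_) a) (map (m′ +_) b)
  Similar-shift m m′ (ps , refl , refl , iso) =
    map shift ps , trans (sym (ListP.map-∘ ps)) (ListP.map-∘ ps) ,
    trans (sym (ListP.map-∘ ps)) (ListP.map-∘ ps) , iso′
    where
    shift : ℕ × ℕ → ℕ × ℕ
    shift = Product.map (m +_) (m′ +_)
    iso′ : OrderIso (map shift ps)
    iso′ p∈ q∈ with ∈-map⁻ shift p∈ | ∈-map⁻ shift q∈
    ... | p , p∈ps , refl | q , q∈ps , refl =
      (λ ≤₁ → ℕP.+-monoʳ-≤ m′ (proj₁ (iso p∈ps q∈ps) (ℕP.+-cancelˡ-≤ m _ _ ≤₁))) ,
      (λ ≤₂ → ℕP.+-monoʳ-≤ m (proj₂ (iso p∈ps q∈ps) (ℕP.+-cancelˡ-≤ m′ _ _ ≤₂)))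

  Similar-refl : ∀ a → Similar a a
  Similar-refl a =
    map (λ x → x , x) a , trans (sym (ListP.map-∘ a)) (ListP.map-id a) ,
    trans (sym (ListP.map-∘ a)) (ListP.map-id a) , iso
    where
    iso : OrderIso (map (λ x → x , x) a)
    iso p∈ q∈ with ∈-map⁻ (λ x → x , x) p∈ | ∈-map⁻ (λ x → x , x) q∈
    ... | _ , _ , refl | _ , _ , refl = (λ le → le) , (λ le → le)

  OrderIso-sh : ∀ ps qs → OrderIso ps → OrderIso qs →
    (∀ {p q} → p ∈ ps → q ∈ qs → proj₁ p < proj₁ q × proj₂ p < proj₂ q) →
    ∀ {rs} → rs ∈ sh ps qs → OrderIso rs
  OrderIso-sh ps qs isoₚ iso_q sep rs∈ p∈ q∈ with ∈-sh⁻ ps qs rs∈ p∈ | ∈-sh⁻ ps qs rs∈ q∈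
  ... | inj₁ p∈ps | inj₁ q∈ps = isoₚ p∈ps q∈ps
  ... | inj₂ p∈qs | inj₂ q∈qs = iso_q p∈qs q∈qs
  ... | inj₁ p∈ps | inj₂ q∈qs =
    (λ _ → ℕP.<⇒≤ (proj₂ (sep p∈ps q∈qs))) , (λ _ → ℕP.<⇒≤ (proj₁ (sep p∈ps q∈qs)))
  ... | inj₂ p∈qs | inj₁ q∈ps =
    (λ ≤₁ → ⊥-elim (ℕP.<⇒≱ (proj₁ (sep q∈ps p∈qs)) ≤₁)) ,
    (λ ≤₂ → ⊥-elim (ℕP.<⇒≱ (proj₂ (sep q∈ps p∈qs)) ≤₂))

  fl-take : ∀ i {a b} → fl a ≡ fl b → fl (take i a) ≡ fl (take i b)
  fl-take i {a} {b} e = Similar⇒fl≡ (Similar-take i (fl≡⇒Similar a b e))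

  fl-drop : ∀ i {a b} → fl a ≡ fl b → fl (drop i a) ≡ fl (drop i b)
  fl-drop i {a} {b} e = Similar⇒fl≡ (Similar-drop i (fl≡⇒Similar a b e))

  fl-shift : ∀ k a → fl (map (k +_) a) ≡ fl a
  fl-shift k a = trans (Similar⇒fl≡ (Similar-shift k 0 (Similar-refl a))) (cong fl (ListP.map-id a))

  fl-sh : ∀ {a a′ b b′} m m′ → fl a ≡ fl a′ → fl b ≡ fl b′ →
    All (_≤ m) a → All (_≤ m′) a′ → All (1 ≤_) b → All (1 ≤_) b′ →
    Pointwise (λ s s′ → fl s ≡ fl s′) (sh a (map (m +_) b)) (sh a′ (map (m′ +_) b′))
  fl-sh {a} {a′} {b} {b′} m m′ ea eb a≤m a′≤m′ 1≤b 1≤b′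
    with fl≡⇒Similar a a′ ea | Similar-shift m m′ (fl≡⇒Similar b b′ eb)
  ... | ps , refl , refl , isoₚ | qs , e₁ , e₂ , iso_q =
    subst₂ (Pointwise _) (trans (sym (map-sh proj₁ ps qs)) (cong (sh (map proj₁ ps)) e₁))
                         (trans (sym (map-sh proj₂ ps qs)) (cong (sh (map proj₂ ps)) e₂))
      (Pointwise.map⁺ (map proj₁) (map proj₂) (All⇒Pointwise-diagonal (All.tabulate (λ rs∈ →
        Similar⇒fl≡ (_ , refl , refl , OrderIso-sh ps qs isoₚ iso_q separated rs∈)))))
    where
    above : ∀ k {cs} → All (1 ≤_) cs → All (k <_) (map (k +_) cs)
    above k 1≤cs = All.map⁺ (All.map (ℕP.m<m+n k) 1≤cs)
    separated : ∀ {p q} → p ∈ ps → q ∈ qs → proj₁ p < proj₁ q × proj₂ p < proj₂ q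
    separated p∈ q∈ =
      ℕP.≤-<-trans (All.lookup a≤m (∈-map⁺ proj₁ p∈))
                   (All.lookup (subst (All _) (sym e₁) (above m 1≤b)) (∈-map⁺ proj₁ q∈)) ,
      ℕP.≤-<-trans (All.lookup a′≤m′ (∈-map⁺ proj₂ p∈))
                   (All.lookup (subst (All _) (sym e₂) (above m′ 1≤b′)) (∈-map⁺ proj₂ q∈))

module Patterns where

  open import Data.Nat using (ℕ; suc; _+_; _≤_; z≤n; s≤s)
  import Data.Nat.Properties as ℕP
  open import Data.Fin using (Fin; toℕ; _↑ˡ_; _↑ʳ_)
  import Data.Fin.Properties as FinP
  open import Data.List using (List; []; _∷_; map; concatMap; length; take; drop)
  import Data.List.Properties as ListP
  open import Data.List.Relation.Unary.All as All using (All; []; _∷_)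
  open import Data.List.Relation.Binary.Pointwise as Pointwise using (Pointwise)
  open import Data.Product using (_×_; _,_; proj₁; proj₂)
  open import Function using (_∘_)
  open import Relation.Binary.PropositionalEquality as ≡ using (_≡_; cong; cong₂; sym; trans; subst₂)
  open Lists
  open Flattening using (fl-take; fl-drop; fl-sh)

  lettersB : Basis → List ℕ
  lettersB (n , w) = letters w

  _≅_ : Basis → Basis → Set
  x ≅ y = flB x ≡ flB y

  length-letters : ∀ {n} (w : List (Fin n)) → length (letters w) ≡ length w
  length-letters w = ListP.length-map _ w

  deg-≅ : ∀ {x y} → x ≅ y → deg x ≡ deg y
  deg-≅ {m , v} {n , w} e = begin
    length v                   ≡⟨ sym (length-letters v) ⟩
    length (letters v)         ≡⟨ sym (ListP.length-map _ (letters v)) ⟩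
    length (fl (letters v))    ≡⟨ cong length e ⟩
    length (fl (letters w))    ≡⟨ ListP.length-map _ (letters w) ⟩
    length (letters w)         ≡⟨ length-letters w ⟩
    length w                   ∎
    where open ≡.≡-Reasoning

  letters-bounded : ∀ {n} (w : List (Fin n)) → All (λ x → 1 ≤ x × x ≤ n) (letters w)
  letters-bounded [] = []
  letters-bounded (i ∷ w) = (s≤s z≤n , FinP.toℕ<n i) ∷ letters-bounded w

  letters-↑ˡ : ∀ {m} (v : List (Fin m)) n → letters (map (_↑ˡ n) v) ≡ letters v
  letters-↑ˡ v n = trans (sym (ListP.map-∘ v)) (ListP.map-cong (λ i → cong suc (FinP.toℕ-↑ˡ i n)) v)

  letters-↑ʳ : ∀ m {n} (w : List (Fin n)) → letters (map (m ↑ʳ_) w) ≡ map (m +_) (letters w)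
  letters-↑ʳ m w = trans (sym (ListP.map-∘ w))
    (trans (ListP.map-cong (λ j → trans (cong suc (FinP.toℕ-↑ʳ m j)) (sym (ℕP.+-suc m (toℕ j)))) w)
           (ListP.map-∘ w))

  ≅-take : ∀ i {m n} {v : List (Fin m)} {w : List (Fin n)} → (m , v) ≅ (n , w) → (m , take i v) ≅ (n , take i w)
  ≅-take i {v = v} {w} e = trans (cong fl (sym (ListP.take-map i v))) (trans (fl-take i e) (cong fl (ListP.take-map i w)))

  ≅-drop : ∀ i {m n} {v : List (Fin m)} {w : List (Fin n)} → (m , v) ≅ (n , w) → (m , drop i v) ≅ (n , drop i w)
  ≅-drop i {v = v} {w} e = trans (cong fl (sym (ListP.drop-map i v))) (trans (fl-drop i e) (cong fl (ListP.drop-map i w)))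

  SplitsRelated : ∀ {m n} → List (Fin m) × List (Fin m) → List (Fin n) × List (Fin n) → Set
  SplitsRelated {m} {n} s s′ = (m , proj₁ s) ≅ (n , proj₁ s′) × (m , proj₂ s) ≅ (n , proj₂ s′)

  initSplits-≅ : ∀ {m n} {v : List (Fin m)} {w : List (Fin n)} → (m , v) ≅ (n , w) →
    Pointwise SplitsRelated (initSplits v) (initSplits w)
  initSplits-≅ {v = v} {w} e rewrite initSplits-applyUpTo v | initSplits-applyUpTo w | deg-≅ e =
    applyUpTo-pointwise (length w) (λ {i} _ → ≅-take i e , ≅-drop i e)

  ΔB-≅ : ∀ {x y} → x ≅ y → Pointwise (λ p q → proj₁ p ≅ proj₁ q × proj₂ p ≅ proj₂ q) (ΔB x) (ΔB y)
  ΔB-≅ {m , v} {n , w} e rewrite deg-≅ e =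
    applyUpTo-pointwise (suc (length w)) (λ {i} _ → ≅-take i e , ≅-drop i e)

  ΔB≡splits : ∀ n (w : List (Fin n)) → ΔB (n , w) ≡ map (λ pq → (n , proj₁ pq) , (n , proj₂ pq)) (splits w)
  ΔB≡splits n w = trans (sym (map-applyUpTo pair (λ i → take i w , drop i w) (suc (length w))))
                        (cong (map pair) (sym (splits-applyUpTo w)))
    where
    pair : List (Fin n) × List (Fin n) → Basis × Basis
    pair pq = (n , proj₁ pq) , (n , proj₂ pq)

  letters-shB : ∀ m (v : List (Fin m)) n (w : List (Fin n)) →
    map lettersB (shB (m , v) (n , w)) ≡ sh (letters v) (map (m +_) (letters w))
  letters-shB m v n w = begin
    map lettersB (map (λ u → m + n , u) (sh (map (_↑ˡ n) v) (map (m ↑ʳ_) w)))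
      ≡⟨ sym (ListP.map-∘ (sh (map (_↑ˡ n) v) (map (m ↑ʳ_) w))) ⟩
    map letters (sh (map (_↑ˡ n) v) (map (m ↑ʳ_) w))
      ≡⟨ sym (map-sh (λ i → suc (toℕ i)) (map (_↑ˡ n) v) (map (m ↑ʳ_) w)) ⟩
    sh (letters (map (_↑ˡ n) v)) (letters (map (m ↑ʳ_) w))
      ≡⟨ cong₂ sh (letters-↑ˡ v n) (letters-↑ʳ m w) ⟩
    sh (letters v) (map (m +_) (letters w)) ∎
    where open ≡.≡-Reasoning

  shB-≅ : ∀ {x x′ z z′} → x ≅ x′ → z ≅ z′ → Pointwise _≅_ (shB x z) (shB x′ z′)
  shB-≅ {m , v} {m′ , v′} {n , w} {n′ , w′} e₁ e₂ =
    Pointwise.map⁻ lettersB lettersB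
      (subst₂ (Pointwise (λ s s′ → fl s ≡ fl s′))
              (sym (letters-shB m v n w)) (sym (letters-shB m′ v′ n′ w′))
        (fl-sh m m′ e₁ e₂
          (All.map proj₂ (letters-bounded v)) (All.map proj₂ (letters-bounded v′))
          (All.map proj₁ (letters-bounded w)) (All.map proj₁ (letters-bounded w′))))

  letters-shB-shBˡ : ∀ x y z → map lettersB (concatMap (λ b → shB b z) (shB x y)) ≡
    sh-shˡ (lettersB x) (map (proj₁ x +_) (lettersB y)) (map ((proj₁ x + proj₁ y) +_) (lettersB z))
  letters-shB-shBˡ (m , v) (n , w) (p , u) = begin
    map lettersB (concatMap (λ b → shB b (p , u)) (map (λ t → m + n , t) S))
      ≡⟨ ListP.map-concatMap lettersB (λ b → shB b (p , u)) (map (λ t → m + n , t) S) ⟩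
    concatMap (λ b → map lettersB (shB b (p , u))) (map (λ t → m + n , t) S)
      ≡⟨ ListP.concatMap-map (λ b → map lettersB (shB b (p , u))) (λ t → m + n , t) S ⟩
    concatMap (λ t → map lettersB (shB (m + n , t) (p , u))) S
      ≡⟨ ListP.concatMap-cong (λ t → letters-shB (m + n) t p u) S ⟩
    concatMap (λ t → sh (letters t) U) S
      ≡⟨ sym (ListP.concatMap-map (λ s → sh s U) letters S) ⟩
    concatMap (λ s → sh s U) (map letters S)
      ≡⟨ cong (concatMap (λ s → sh s U)) (trans (ListP.map-∘ S) (letters-shB m v n w)) ⟩
    sh-shˡ (letters v) (map (m +_) (letters w)) U ∎
    where
    open ≡.≡-Reasoning
    S = sh (map (_↑ˡ n) v) (map (m ↑ʳ_) w)
    U = map ((m + n) +_) (letters u)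

  letters-shB-shBʳ : ∀ x y z → map lettersB (concatMap (shB x) (shB y z)) ≡
    sh-shʳ (lettersB x) (map (proj₁ x +_) (lettersB y)) (map ((proj₁ x + proj₁ y) +_) (lettersB z))
  letters-shB-shBʳ (m , v) (n , w) (p , u) = begin
    map lettersB (concatMap (shB (m , v)) (map (λ t → n + p , t) S))
      ≡⟨ ListP.map-concatMap lettersB (shB (m , v)) (map (λ t → n + p , t) S) ⟩
    concatMap (λ b → map lettersB (shB (m , v) b)) (map (λ t → n + p , t) S)
      ≡⟨ ListP.concatMap-map (λ b → map lettersB (shB (m , v) b)) (λ t → n + p , t) S ⟩
    concatMap (λ t → map lettersB (shB (m , v) (n + p , t))) S
      ≡⟨ ListP.concatMap-cong (λ t → letters-shB m v (n + p) t) S ⟩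
    concatMap (λ t → sh (letters v) (map (m +_) (letters t))) S
      ≡⟨ sym (ListP.concatMap-map (sh (letters v)) (map (m +_) ∘ letters) S) ⟩
    concatMap (sh (letters v)) (map (map (m +_) ∘ letters) S)
      ≡⟨ cong (concatMap (sh (letters v))) shifted ⟩
    sh-shʳ (letters v) (map (m +_) (letters w)) (map ((m + n) +_) (letters u)) ∎
    where
    open ≡.≡-Reasoning
    S = sh (map (_↑ˡ p) w) (map (n ↑ʳ_) u)
    shifted : map (map (m +_) ∘ letters) S ≡ sh (map (m +_) (letters w)) (map ((m + n) +_) (letters u))
    shifted = begin
      map (map (m +_) ∘ letters) S
        ≡⟨ trans (ListP.map-∘ S) (cong (map (map (m +_))) (trans (ListP.map-∘ S) (letters-shB n w p u))) ⟩
      map (map (m +_)) (sh (letters w) (map (n +_) (letters u)))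
        ≡⟨ sym (map-sh (m +_) (letters w) (map (n +_) (letters u))) ⟩
      sh (map (m +_) (letters w)) (map (m +_) (map (n +_) (letters u)))
        ≡⟨ cong (sh (map (m +_) (letters w)))
             (trans (sym (ListP.map-∘ (letters u)))
                    (ListP.map-cong (λ k → sym (ℕP.+-assoc m n k)) (letters u))) ⟩
      sh (map (m +_) (letters w)) (map ((m + n) +_) (letters u)) ∎

module FreeSpace {c ℓ} (F : Field c ℓ) where

  open Field F
  open Over F
  open import Data.List using (List; []; _∷_; _++_; map; concatMap; deduplicate)
  open import Data.List.Relation.Unary.All as All using (All; []; _∷_)
  open import Data.List.Relation.Unary.Any using (here; there)
  open import Data.List.Relation.Unary.AllPairs using ([]; _∷_)
  open import Data.List.Relation.Unary.Unique.Propositional using (Unique)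
  open import Data.List.Relation.Unary.Unique.DecPropositional.Properties using (deduplicate-!)
  open import Data.List.Membership.Propositional using (_∈_; _∉_)
  open import Data.List.Membership.Propositional.Properties using (∈-deduplicate⁺; ∈-map⁺; ∈-++⁺ˡ; ∈-++⁺ʳ)
  open import Data.List.Relation.Binary.Permutation.Propositional as Perm using (_↭_)
  open import Data.List.Relation.Binary.Pointwise using (Pointwise; []; _∷_)
  open import Level using (_⊔_)
  open import Data.Product using (Σ-syntax; _,_; proj₂)
  open import Data.Empty using (⊥-elim)
  open import Function using (_∘_)
  open import Relation.Nullary using (yes; no)
  open import Relation.Binary.Definitions using (DecidableEquality)
  open import Relation.Binary.Bundles using (Setoid)
  import Relation.Binary.Reasoning.Setoid
  import Relation.Binary.PropositionalEquality as ≡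
  import Data.List.Properties as ListP
  open import Algebra.Properties.Ring ring using (-1*x≈-x; x[y-z]≈xy-xz)
  open import Algebra.Properties.AbelianGroup +-abelianGroup using (⁻¹-∙-comm; ⁻¹-anti-homo‿-)
  open import Algebra.Properties.CommutativeSemigroup +-commutativeSemigroup
    using (interchange) renaming (x∙yz≈y∙xz to x+[y+z]≈y+[x+z])
  open import Algebra.Properties.CommutativeSemigroup *-commutativeSemigroup
    using () renaming (x∙yz≈y∙xz to x*[y*z]≈y*[x*z])
  open import Relation.Binary.Reasoning.Setoid setoid

  eval : ∀ {X : Set} → (X → Carrier) → Free X → Carrier
  eval g [] = 0#
  eval g ((a , x) ∷ u) = a * g x + eval g u

  eval-++ : ∀ {X : Set} (g : X → Carrier) u v → eval g (u ++ v) ≈ eval g u + eval g v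
  eval-++ g [] v = sym (+-identityˡ _)
  eval-++ g ((a , x) ∷ u) v = trans (+-congˡ (eval-++ g u v)) (sym (+-assoc _ _ _))

  eval-· : ∀ {X : Set} (g : X → Carrier) a u → eval g (a · u) ≈ a * eval g u
  eval-· g a [] = sym (zeroʳ a)
  eval-· g a ((b , x) ∷ u) = begin
    a * b * g x + eval g (a · u)  ≈⟨ +-cong (*-assoc a b (g x)) (eval-· g a u) ⟩
    a * (b * g x) + a * eval g u  ≈⟨ distribˡ a _ _ ⟨
    a * (b * g x + eval g u)      ∎

  eval-⟦⟧ : ∀ {X : Set} (g : X → Carrier) x → eval g ⟦ x ⟧ ≈ g x
  eval-⟦⟧ g x = trans (+-identityʳ _) (*-identityˡ _)

  eval-⊖ : ∀ {X : Set} (g : X → Carrier) u v → eval g (u ⊖ v) ≈ eval g u - eval g v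
  eval-⊖ g u v = trans (eval-++ g u ((- 1#) · v)) (+-congˡ (trans (eval-· g (- 1#) v) (-1*x≈-x _)))

  eval-cong : ∀ {X : Set} {g h : X → Carrier} → (∀ x → g x ≈ h x) → ∀ u → eval g u ≈ eval h u
  eval-cong g≈h [] = refl
  eval-cong g≈h ((a , x) ∷ u) = +-cong (*-congˡ (g≈h x)) (eval-cong g≈h u)

  eval-zero : ∀ {X : Set} (g : X → Carrier) → (∀ x → g x ≈ 0#) → ∀ u → eval g u ≈ 0#
  eval-zero g g≈0 [] = refl
  eval-zero g g≈0 ((a , x) ∷ u) = begin
    a * g x + eval g u  ≈⟨ +-cong (*-congˡ (g≈0 x)) (eval-zero g g≈0 u) ⟩
    a * 0# + 0#         ≈⟨ +-identityʳ _ ⟩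
    a * 0#              ≈⟨ zeroʳ a ⟩
    0#                  ∎

  eval-+ᶠ : ∀ {X : Set} (g h : X → Carrier) u → eval (λ x → g x + h x) u ≈ eval g u + eval h u
  eval-+ᶠ g h [] = sym (+-identityʳ 0#)
  eval-+ᶠ g h ((a , x) ∷ u) = trans (+-cong (distribˡ a (g x) (h x)) (eval-+ᶠ g h u)) (interchange _ _ _ _)

  eval-*ᶠ : ∀ {X : Set} (g : X → Carrier) a u → eval (λ x → a * g x) u ≈ a * eval g u
  eval-*ᶠ g a [] = sym (zeroʳ a)
  eval-*ᶠ g a ((b , x) ∷ u) = trans (+-cong (x*[y*z]≈y*[x*z] b a (g x)) (eval-*ᶠ g a u)) (sym (distribˡ a _ _))

  eval-lin : ∀ {X Y : Set} (h : Y → Carrier) (f : X → Free Y) u → eval h (lin f u) ≈ eval (eval h ∘ f) u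
  eval-lin h f [] = refl
  eval-lin h f ((a , x) ∷ u) = begin
    eval h (a · f x ++ lin f u)          ≈⟨ eval-++ h (a · f x) (lin f u) ⟩
    eval h (a · f x) + eval h (lin f u)  ≈⟨ +-cong (eval-· h a (f x)) (eval-lin h f u) ⟩
    a * eval h (f x) + eval (eval h ∘ f) u ∎

  eval-comm : ∀ {X Y : Set} (h : X → Y → Carrier) u (v : Free Y) →
    eval (λ x → eval (h x) v) u ≈ eval (λ y → eval (λ x → h x y) u) v
  eval-comm h [] v = sym (eval-zero _ (λ _ → refl) v)
  eval-comm h ((a , x) ∷ u) v = begin
    a * eval (h x) v + eval (λ x → eval (h x) v) u
      ≈⟨ +-cong (sym (eval-*ᶠ (h x) a v)) (eval-comm h u v) ⟩
    eval (λ y → a * h x y) v + eval (λ y → eval (λ x → h x y) u) v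
      ≈⟨ eval-+ᶠ _ _ v ⟨
    eval (λ y → a * h x y + eval (λ x → h x y) u) v ∎

  eval-↭ : ∀ {X : Set} (g : X → Carrier) {u v} → u ↭ v → eval g u ≈ eval g v
  eval-↭ g Perm.refl = refl
  eval-↭ g (Perm.prep (a , x) p) = +-congˡ (eval-↭ g p)
  eval-↭ g (Perm.swap (a , x) (b , y) p) = trans (+-congˡ (+-congˡ (eval-↭ g p))) (x+[y+z]≈y+[x+z] _ _ _)
  eval-↭ g (Perm.trans p q) = trans (eval-↭ g p) (eval-↭ g q)

  formalSum : ∀ {X : Set} → List X → Free X
  formalSum L = map (λ x → 1# , x) L

  module Coordinates {X : Set} (_≟_ : DecidableEquality X) where

    -- The relation _≈F_ of Defs, packed in a record so that u and v can be inferred from a proof.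
    infix 4 _≋_
    record _≋_ (u v : Free X) : Set ℓ where
      constructor mk≋
      field coeff-≈ : ∀ x → coeff _≟_ x u ≈ coeff _≟_ x v
    open _≋_ public

    δ : X → X → Carrier
    δ x y with x ≟ y
    ... | yes _ = 1#
    ... | no _ = 0#

    coeff≈eval-δ : ∀ x u → coeff _≟_ x u ≈ eval (δ x) u
    coeff≈eval-δ x [] = refl
    coeff≈eval-δ x ((a , y) ∷ u) with x ≟ y
    ... | yes _ = +-cong (sym (*-identityʳ a)) (coeff≈eval-δ x u)
    ... | no _ = trans (coeff≈eval-δ x u) (sym (trans (+-congʳ (zeroʳ a)) (+-identityˡ _)))

    coeff-⟦⟧ : ∀ x y → coeff _≟_ x ⟦ y ⟧ ≈ δ x y
    coeff-⟦⟧ x y = trans (coeff≈eval-δ x ⟦ y ⟧) (trans (+-identityʳ _) (*-identityˡ _))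

    coeff-∷ : ∀ x a y u → coeff _≟_ x ((a , y) ∷ u) ≈ a * δ x y + coeff _≟_ x u
    coeff-∷ x a y u = trans (coeff≈eval-δ x ((a , y) ∷ u)) (+-congˡ (sym (coeff≈eval-δ x u)))

    coeff-++ : ∀ x u v → coeff _≟_ x (u ++ v) ≈ coeff _≟_ x u + coeff _≟_ x v
    coeff-++ x u v = begin
      coeff _≟_ x (u ++ v)                      ≈⟨ coeff≈eval-δ x (u ++ v) ⟩
      eval (δ x) (u ++ v)                        ≈⟨ eval-++ (δ x) u v ⟩
      eval (δ x) u + eval (δ x) v                ≈⟨ +-cong (coeff≈eval-δ x u) (coeff≈eval-δ x v) ⟨
      coeff _≟_ x u + coeff _≟_ x v ∎

    coeff-· : ∀ x a u → coeff _≟_ x (a · u) ≈ a * coeff _≟_ x u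
    coeff-· x a u = begin
      coeff _≟_ x (a · u)   ≈⟨ coeff≈eval-δ x (a · u) ⟩
      eval (δ x) (a · u)     ≈⟨ eval-· (δ x) a u ⟩
      a * eval (δ x) u       ≈⟨ *-congˡ (coeff≈eval-δ x u) ⟨
      a * coeff _≟_ x u      ∎

    coeff-⊖ : ∀ x u v → coeff _≟_ x (u ⊖ v) ≈ coeff _≟_ x u - coeff _≟_ x v
    coeff-⊖ x u v = trans (coeff-++ x u ((- 1#) · v)) (+-congˡ (trans (coeff-· x (- 1#) v) (-1*x≈-x _)))

    private
      sumOver : (X → Carrier) → List X → Carrier
      sumOver h [] = 0#
      sumOver h (k ∷ K) = h k + sumOver h K

      sumOver-cong : ∀ {h h′ : X → Carrier} → (∀ x → h x ≈ h′ x) → ∀ K →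
        sumOver h K ≈ sumOver h′ K
      sumOver-cong h≈h′ [] = refl
      sumOver-cong h≈h′ (k ∷ K) = +-cong (h≈h′ k) (sumOver-cong h≈h′ K)

      sumOver-0* : ∀ (g : X → Carrier) K → sumOver (λ x → 0# * g x) K ≈ 0#
      sumOver-0* g [] = refl
      sumOver-0* g (k ∷ K) = trans (+-cong (zeroˡ _) (sumOver-0* g K)) (+-identityʳ _)

      sumOver-∉ : ∀ (g : X → Carrier) a y t K → y ∉ K →
        sumOver (λ x → coeff _≟_ x ((a , y) ∷ t) * g x) K ≈ sumOver (λ x → coeff _≟_ x t * g x) K
      sumOver-∉ g a y t [] _ = refl
      sumOver-∉ g a y t (k ∷ K) y∉ with k ≟ y
      ... | yes ≡.refl = ⊥-elim (y∉ (here ≡.refl))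
      ... | no _ = +-congˡ (sumOver-∉ g a y t K (y∉ ∘ there))

      sumOver-∈ : ∀ (g : X → Carrier) a y t K → Unique K → y ∈ K →
        sumOver (λ x → coeff _≟_ x ((a , y) ∷ t) * g x) K
          ≈ a * g y + sumOver (λ x → coeff _≟_ x t * g x) K
      sumOver-∈ g a y t (k ∷ K) (k∉K ∷ !K) y∈ with k ≟ y
      sumOver-∈ g a y t (k ∷ K) (k∉K ∷ !K) y∈ | yes ≡.refl = begin
        (a + coeff _≟_ k t) * g k + sumOver (λ x → coeff _≟_ x ((a , k) ∷ t) * g x) K
          ≈⟨ +-cong (distribʳ _ _ _) (sumOver-∉ g a k t K (λ k∈K → All.lookup k∉K k∈K ≡.refl)) ⟩
        (a * g k + coeff _≟_ k t * g k) + sumOver (λ x → coeff _≟_ x t * g x) K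
          ≈⟨ +-assoc _ _ _ ⟩
        a * g k + (coeff _≟_ k t * g k + sumOver (λ x → coeff _≟_ x t * g x) K) ∎
      sumOver-∈ g a y t (k ∷ K) (k∉K ∷ !K) (here ≡.refl) | no k≢y = ⊥-elim (k≢y ≡.refl)
      sumOver-∈ g a y t (k ∷ K) (k∉K ∷ !K) (there y∈) | no _ = begin
        coeff _≟_ k t * g k + sumOver (λ x → coeff _≟_ x ((a , y) ∷ t) * g x) K
          ≈⟨ +-congˡ (sumOver-∈ g a y t K !K y∈) ⟩
        coeff _≟_ k t * g k + (a * g y + sumOver (λ x → coeff _≟_ x t * g x) K)
          ≈⟨ x+[y+z]≈y+[x+z] _ _ _ ⟩
        a * g y + (coeff _≟_ k t * g k + sumOver (λ x → coeff _≟_ x t * g x) K) ∎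

      eval≈sumOver : ∀ (g : X → Carrier) u K → Unique K → All (λ p → proj₂ p ∈ K) u →
        eval g u ≈ sumOver (λ x → coeff _≟_ x u * g x) K
      eval≈sumOver g [] K !K _ = sym (sumOver-0* g K)
      eval≈sumOver g ((a , y) ∷ t) K !K (y∈ ∷ t⊆K) =
        trans (+-congˡ (eval≈sumOver g t K !K t⊆K)) (sym (sumOver-∈ g a y t K !K y∈))

    -- Both sums are rewritten as sums over the common (duplicate-free) support of u and v.
    eval-resp : ∀ (g : X → Carrier) {u v} → u ≋ v → eval g u ≈ eval g v
    eval-resp g {u} {v} u≋v = begin
      eval g u
        ≈⟨ eval≈sumOver g u K !K (All.tabulate (λ p∈ → ∈-deduplicate⁺ _≟_ (∈-map⁺ proj₂ (∈-++⁺ˡ p∈)))) ⟩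
      sumOver (λ x → coeff _≟_ x u * g x) K
        ≈⟨ sumOver-cong (λ x → *-congʳ (coeff-≈ u≋v x)) K ⟩
      sumOver (λ x → coeff _≟_ x v * g x) K
        ≈⟨ eval≈sumOver g v K !K (All.tabulate (λ p∈ → ∈-deduplicate⁺ _≟_ (∈-map⁺ proj₂ (∈-++⁺ʳ u p∈)))) ⟨
      eval g v ∎
      where
      K = deduplicate _≟_ (map proj₂ (u ++ v))
      !K = deduplicate-! _≟_ (map proj₂ (u ++ v))

    ≋-refl : ∀ {u} → u ≋ u
    ≋-refl = mk≋ (λ x → refl)

    ≋-reflexive : ∀ {u v} → u ≡.≡ v → u ≋ v
    ≋-reflexive ≡.refl = ≋-refl

    ≋-sym : ∀ {u v} → u ≋ v → v ≋ u
    ≋-sym u≋v = mk≋ (λ x → sym (coeff-≈ u≋v x))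

    ≋-trans : ∀ {u v w} → u ≋ v → v ≋ w → u ≋ w
    ≋-trans u≋v v≋w = mk≋ (λ x → trans (coeff-≈ u≋v x) (coeff-≈ v≋w x))

    ≋-setoid : Setoid c ℓ
    ≋-setoid = record
      { Carrier = Free X ; _≈_ = _≋_
      ; isEquivalence = record { refl = ≋-refl ; sym = ≋-sym ; trans = ≋-trans } }

    module ≋-Reasoning = Relation.Binary.Reasoning.Setoid ≋-setoid

    ↭⇒≋ : ∀ {u v} → u ↭ v → u ≋ v
    ↭⇒≋ {u} {v} p = mk≋ λ x → trans (coeff≈eval-δ x u) (trans (eval-↭ (δ x) p) (sym (coeff≈eval-δ x v)))

    ⊕-cong : ∀ {u u′ v v′} → u ≋ u′ → v ≋ v′ → u ⊕ v ≋ u′ ⊕ v′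
    ⊕-cong {u} {u′} {v} {v′} u≋u′ v≋v′ =
      mk≋ λ x → trans (coeff-++ x u v) (trans (+-cong (coeff-≈ u≋u′ x) (coeff-≈ v≋v′ x)) (sym (coeff-++ x u′ v′)))

    ·-cong : ∀ a {u v} → u ≋ v → a · u ≋ a · v
    ·-cong a {u} {v} u≋v =
      mk≋ λ x → trans (coeff-· x a u) (trans (*-congˡ (coeff-≈ u≋v x)) (sym (coeff-· x a v)))

    ⊖-cong : ∀ {u u′ v v′} → u ≋ u′ → v ≋ v′ → u ⊖ v ≋ u′ ⊖ v′
    ⊖-cong u≋u′ v≋v′ = ⊕-cong u≋u′ (·-cong (- 1#) v≋v′)

    ∷≋·⟦⟧⊕ : ∀ a x u → (a , x) ∷ u ≋ a · ⟦ x ⟧ ⊕ u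
    ∷≋·⟦⟧⊕ a x u = mk≋ λ y →
      trans (coeff-∷ y a x u) (sym (trans (coeff-∷ y (a * 1#) x u) (+-congʳ (*-congʳ (*-identityʳ a)))))

    concatMap-≋ : ∀ {Z : Set} {f g : Z → Free X} → (∀ z → f z ≋ g z) → ∀ L →
      concatMap f L ≋ concatMap g L
    concatMap-≋ f≋g [] = ≋-refl
    concatMap-≋ f≋g (z ∷ L) = ⊕-cong (f≋g z) (concatMap-≋ f≋g L)

    concatMap-≋[] : ∀ {Z : Set} {f : Z → Free X} → (∀ z → f z ≋ []) → ∀ L → concatMap f L ≋ []
    concatMap-≋[] f≋[] [] = ≋-refl
    concatMap-≋[] f≋[] (z ∷ L) = ⊕-cong (f≋[] z) (concatMap-≋[] f≋[] L)

    ⊕-comm : ∀ u v → u ⊕ v ≋ v ⊕ u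
    ⊕-comm u v = mk≋ (λ x → trans (coeff-++ x u v) (trans (+-comm _ _) (sym (coeff-++ x v u))))

    ⊕-identityʳ : ∀ u → u ⊕ [] ≋ u
    ⊕-identityʳ u = ≋-reflexive (ListP.++-identityʳ u)

    ⊖-self : ∀ u → u ⊖ u ≋ []
    ⊖-self u = mk≋ (λ x → trans (coeff-⊖ x u u) (-‿inverseʳ _))

    ≋⇒⊖≋[] : ∀ {u v} → u ≋ v → u ⊖ v ≋ []
    ≋⇒⊖≋[] {u} {v} u≋v = ≋-trans (⊖-cong u≋v ≋-refl) (⊖-self v)

    ⊖-interchange : ∀ u v u′ v′ → (u ⊕ v) ⊖ (u′ ⊕ v′) ≋ (u ⊖ u′) ⊕ (v ⊖ v′)
    ⊖-interchange u v u′ v′ = mk≋ λ x → begin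
      coeff _≟_ x ((u ⊕ v) ⊖ (u′ ⊕ v′))
        ≈⟨ trans (coeff-⊖ x (u ⊕ v) (u′ ⊕ v′)) (+-cong (coeff-++ x u v) (-‿cong (coeff-++ x u′ v′))) ⟩
      (coeff _≟_ x u + coeff _≟_ x v) - (coeff _≟_ x u′ + coeff _≟_ x v′)
        ≈⟨ +-congˡ (⁻¹-∙-comm _ _) ⟨
      (coeff _≟_ x u + coeff _≟_ x v) + (- coeff _≟_ x u′ + - coeff _≟_ x v′)
        ≈⟨ interchange _ _ _ _ ⟩
      (coeff _≟_ x u - coeff _≟_ x u′) + (coeff _≟_ x v - coeff _≟_ x v′)
        ≈⟨ trans (coeff-++ x (u ⊖ u′) (v ⊖ v′)) (+-cong (coeff-⊖ x u u′) (coeff-⊖ x v v′)) ⟨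
      coeff _≟_ x ((u ⊖ u′) ⊕ (v ⊖ v′)) ∎

    ⊖-telescope : ∀ u v w → (u ⊖ v) ⊕ (v ⊖ w) ≋ u ⊖ w
    ⊖-telescope u v w = mk≋ λ x → begin
      coeff _≟_ x ((u ⊖ v) ⊕ (v ⊖ w))
        ≈⟨ trans (coeff-++ x (u ⊖ v) (v ⊖ w)) (+-cong (coeff-⊖ x u v) (coeff-⊖ x v w)) ⟩
      (coeff _≟_ x u - coeff _≟_ x v) + (coeff _≟_ x v - coeff _≟_ x w)
        ≈⟨ +-assoc _ _ _ ⟩
      coeff _≟_ x u + (- coeff _≟_ x v + (coeff _≟_ x v - coeff _≟_ x w))
        ≈⟨ +-congˡ (trans (sym (+-assoc _ _ _)) (trans (+-congʳ (-‿inverseˡ _)) (+-identityˡ _))) ⟩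
      coeff _≟_ x u - coeff _≟_ x w
        ≈⟨ coeff-⊖ x u w ⟨
      coeff _≟_ x (u ⊖ w) ∎

    ⊖-anticomm : ∀ u v → v ⊖ u ≋ (- 1#) · (u ⊖ v)
    ⊖-anticomm u v = mk≋ λ x → begin
      coeff _≟_ x (v ⊖ u)               ≈⟨ coeff-⊖ x v u ⟩
      coeff _≟_ x v - coeff _≟_ x u     ≈⟨ ⁻¹-anti-homo‿- _ _ ⟨
      - (coeff _≟_ x u - coeff _≟_ x v) ≈⟨ trans (-1*x≈-x _) (-‿cong (coeff-⊖ x u v)) ⟨
      - 1# * coeff _≟_ x (u ⊖ v)        ≈⟨ coeff-· x (- 1#) (u ⊖ v) ⟨
      coeff _≟_ x ((- 1#) · (u ⊖ v))    ∎

    ·-distrib-⊖ : ∀ a u v → a · u ⊖ a · v ≋ a · (u ⊖ v)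
    ·-distrib-⊖ a u v = mk≋ λ x → begin
      coeff _≟_ x (a · u ⊖ a · v)
        ≈⟨ trans (coeff-⊖ x (a · u) (a · v)) (+-cong (coeff-· x a u) (-‿cong (coeff-· x a v))) ⟩
      a * coeff _≟_ x u - a * coeff _≟_ x v
        ≈⟨ x[y-z]≈xy-xz a _ _ ⟨
      a * (coeff _≟_ x u - coeff _≟_ x v)
        ≈⟨ trans (coeff-· x a (u ⊖ v)) (*-congˡ (coeff-⊖ x u v)) ⟨
      coeff _≟_ x (a · (u ⊖ v)) ∎

  module LinearMaps {Y : Set} (_≟_ : DecidableEquality Y) where

    open Coordinates _≟_

    coeff-lin : ∀ {X : Set} y (f : X → Free Y) u → coeff _≟_ y (lin f u) ≈ eval (coeff _≟_ y ∘ f) u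
    coeff-lin y f u = trans (coeff≈eval-δ y (lin f u))
      (trans (eval-lin (δ y) f u) (eval-cong (λ x → sym (coeff≈eval-δ y (f x))) u))

    lin-++ : ∀ {X : Set} (f : X → Free Y) u v → lin f (u ++ v) ≡.≡ lin f u ++ lin f v
    lin-++ f [] v = ≡.refl
    lin-++ f ((a , x) ∷ u) v =
      ≡.trans (≡.cong (a · f x ++_) (lin-++ f u v)) (≡.sym (ListP.++-assoc (a · f x) (lin f u) (lin f v)))

    lin-cong : ∀ {X : Set} {f g : X → Free Y} → (∀ x → f x ≋ g x) → ∀ u → lin f u ≋ lin g u
    lin-cong {f = f} {g} f≋g u = mk≋ λ y →
      trans (coeff-lin y f u) (trans (eval-cong (λ x → coeff-≈ (f≋g x) y) u) (sym (coeff-lin y g u)))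

    lin-· : ∀ {X : Set} (f : X → Free Y) a u → lin f (a · u) ≋ a · lin f u
    lin-· f a u = mk≋ λ y → begin
      coeff _≟_ y (lin f (a · u))      ≈⟨ coeff-lin y f (a · u) ⟩
      eval (coeff _≟_ y ∘ f) (a · u)   ≈⟨ eval-· _ a u ⟩
      a * eval (coeff _≟_ y ∘ f) u     ≈⟨ trans (coeff-· y a (lin f u)) (*-congˡ (coeff-lin y f u)) ⟨
      coeff _≟_ y (a · lin f u)        ∎

    lin-⊖ : ∀ {X : Set} (f : X → Free Y) u v → lin f (u ⊖ v) ≋ lin f u ⊖ lin f v
    lin-⊖ f u v = ≋-trans (≋-reflexive (lin-++ f u ((- 1#) · v))) (⊕-cong ≋-refl (lin-· f (- 1#) v))

    lin-⟦⟧ : ∀ {X : Set} (f : X → Free Y) x → lin f ⟦ x ⟧ ≋ f x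
    lin-⟦⟧ f x = mk≋ λ y → trans (coeff-lin y f ⟦ x ⟧) (trans (+-identityʳ _) (*-identityˡ _))

    lin-id : ∀ u → lin ⟦_⟧ u ≋ u
    lin-id u = mk≋ λ y →
      trans (coeff-lin y ⟦_⟧ u) (trans (eval-cong (coeff-⟦⟧ y) u) (sym (coeff≈eval-δ y u)))

    lin-⊖ᶠ : ∀ {X : Set} (f g : X → Free Y) u → lin (λ x → f x ⊖ g x) u ≋ lin f u ⊖ lin g u
    lin-⊖ᶠ f g u = mk≋ λ y → begin
      coeff _≟_ y (lin (λ x → f x ⊖ g x) u)
        ≈⟨ trans (coeff-lin y _ u) (eval-cong (λ x → coeff-⊖ y (f x) (g x)) u) ⟩
      eval (λ x → coeff _≟_ y (f x) + - coeff _≟_ y (g x)) u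
        ≈⟨ eval-+ᶠ _ _ u ⟩
      eval (coeff _≟_ y ∘ f) u + eval (λ x → - coeff _≟_ y (g x)) u
        ≈⟨ +-congˡ (trans (eval-cong (λ x → sym (-1*x≈-x _)) u)
                          (trans (eval-*ᶠ _ (- 1#) u) (-1*x≈-x _))) ⟩
      eval (coeff _≟_ y ∘ f) u - eval (coeff _≟_ y ∘ g) u
        ≈⟨ trans (coeff-⊖ y (lin f u) (lin g u)) (+-cong (coeff-lin y f u) (-‿cong (coeff-lin y g u))) ⟨
      coeff _≟_ y (lin f u ⊖ lin g u) ∎

    lin-∘ : ∀ {X Z : Set} (f : Z → Free Y) (g : X → Free Z) u → lin f (lin g u) ≋ lin (lin f ∘ g) u
    lin-∘ f g u = mk≋ λ y → begin
      coeff _≟_ y (lin f (lin g u))               ≈⟨ coeff-lin y f (lin g u) ⟩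
      eval (coeff _≟_ y ∘ f) (lin g u)            ≈⟨ eval-lin _ g u ⟩
      eval (eval (coeff _≟_ y ∘ f) ∘ g) u         ≈⟨ eval-cong (λ x → coeff-lin y f (g x)) u ⟨
      eval (coeff _≟_ y ∘ lin f ∘ g) u            ≈⟨ coeff-lin y _ u ⟨
      coeff _≟_ y (lin (lin f ∘ g) u)             ∎

    lin-comm : ∀ {X Z : Set} (M : X → Z → Free Y) u v →
      lin (λ x → lin (M x) v) u ≋ lin (λ z → lin (λ x → M x z) u) v
    lin-comm M u v = mk≋ λ y → begin
      coeff _≟_ y (lin (λ x → lin (M x) v) u)
        ≈⟨ trans (coeff-lin y _ u) (eval-cong (λ x → coeff-lin y (M x) v) u) ⟩
      eval (λ x → eval (λ z → coeff _≟_ y (M x z)) v) u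
        ≈⟨ eval-comm (λ x z → coeff _≟_ y (M x z)) u v ⟩
      eval (λ z → eval (λ x → coeff _≟_ y (M x z)) u) v
        ≈⟨ trans (coeff-lin y _ v) (eval-cong (λ z → coeff-lin y (λ x → M x z) u) v) ⟨
      coeff _≟_ y (lin (λ z → lin (λ x → M x z) u) v) ∎

    lin-concatMap : ∀ {X Z : Set} (f : X → Free Y) (g : Z → Free X) L →
      lin f (concatMap g L) ≡.≡ concatMap (lin f ∘ g) L
    lin-concatMap f g [] = ≡.refl
    lin-concatMap f g (z ∷ L) =
      ≡.trans (lin-++ f (g z) (concatMap g L)) (≡.cong (lin f (g z) ++_) (lin-concatMap f g L))

    lin-formalSum : ∀ {X : Set} (f : X → Free Y) L → lin f (formalSum L) ≋ concatMap f L
    lin-formalSum f [] = ≋-refl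
    lin-formalSum f (x ∷ L) =
      ⊕-cong (mk≋ λ y → trans (coeff-· y 1# (f x)) (*-identityˡ _)) (lin-formalSum f L)

  lin-resp : ∀ {X Y : Set} (_≟X_ : DecidableEquality X) (_≟Y_ : DecidableEquality Y) (f : X → Free Y) {u v} →
    Coordinates._≋_ _≟X_ u v → Coordinates._≋_ _≟Y_ (lin f u) (lin f v)
  lin-resp _≟X_ _≟Y_ f {u} {v} u≋v = Y.mk≋ λ y →
    trans (coeff-lin y f u) (trans (X.eval-resp (coeff _≟Y_ y ∘ f) u≋v) (sym (coeff-lin y f v)))
    where
    module X = Coordinates _≟X_
    module Y = Coordinates _≟Y_
    open LinearMaps _≟Y_ using (coeff-lin)

  module Span {X G : Set} (_≟_ : DecidableEquality X) (gen : G → Free X) where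

    open Coordinates _≟_
    open LinearMaps _≟_

    InSpan : Free X → Set (c ⊔ ℓ)
    InSpan u = Σ[ gs ∈ Free G ] u ≋ lin gen gs

    InSpan-resp : ∀ {u v} → u ≋ v → InSpan v → InSpan u
    InSpan-resp u≋v (gs , v≋) = gs , ≋-trans u≋v v≋

    InSpan-[] : InSpan []
    InSpan-[] = [] , ≋-refl

    InSpan-⊕ : ∀ {u v} → InSpan u → InSpan v → InSpan (u ⊕ v)
    InSpan-⊕ (gs , u≋) (hs , v≋) =
      gs ++ hs , ≋-trans (⊕-cong u≋ v≋) (≋-sym (≋-reflexive (lin-++ gen gs hs)))

    InSpan-· : ∀ a {u} → InSpan u → InSpan (a · u)
    InSpan-· a (gs , u≋) = a · gs , ≋-trans (·-cong a u≋) (≋-sym (lin-· gen a gs))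

    InSpan-gen : ∀ g → InSpan (gen g)
    InSpan-gen g = ⟦ g ⟧ , ≋-sym (lin-⟦⟧ gen g)

    InSpan-lin : ∀ {Z : Set} (f : Z → Free X) → (∀ z → InSpan (f z)) → ∀ u → InSpan (lin f u)
    InSpan-lin f f∈ [] = InSpan-[]
    InSpan-lin f f∈ ((a , z) ∷ u) = InSpan-⊕ (InSpan-· a (f∈ z)) (InSpan-lin f f∈ u)

    infix 4 _∼_
    record _∼_ (u v : Free X) : Set (c ⊔ ℓ) where
      constructor ⟪_⟫
      field ⊖-InSpan : InSpan (u ⊖ v)
    open _∼_ public

    ≋⇒∼ : ∀ {u v} → u ≋ v → u ∼ v
    ≋⇒∼ u≋v = ⟪ InSpan-resp (≋⇒⊖≋[] u≋v) InSpan-[] ⟫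

    ∼-refl : ∀ {u} → u ∼ u
    ∼-refl = ≋⇒∼ ≋-refl

    ∼-sym : ∀ {u v} → u ∼ v → v ∼ u
    ∼-sym {u} {v} ⟪ u⊖v ⟫ = ⟪ InSpan-resp (⊖-anticomm u v) (InSpan-· (- 1#) u⊖v) ⟫

    ∼-trans : ∀ {u v w} → u ∼ v → v ∼ w → u ∼ w
    ∼-trans {u} {v} {w} ⟪ u⊖v ⟫ ⟪ v⊖w ⟫ =
      ⟪ InSpan-resp (≋-sym (⊖-telescope u v w)) (InSpan-⊕ u⊖v v⊖w) ⟫

    ∼-resp : ∀ {u u′ v v′} → u ≋ u′ → v ≋ v′ → u′ ∼ v′ → u ∼ v
    ∼-resp u≋u′ v≋v′ u′∼v′ = ∼-trans (≋⇒∼ u≋u′) (∼-trans u′∼v′ (≋⇒∼ (≋-sym v≋v′)))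

    ∼-⊕ : ∀ {u u′ v v′} → u ∼ u′ → v ∼ v′ → u ⊕ v ∼ u′ ⊕ v′
    ∼-⊕ {u} {u′} {v} {v′} ⟪ u⊖u′ ⟫ ⟪ v⊖v′ ⟫ =
      ⟪ InSpan-resp (⊖-interchange u v u′ v′) (InSpan-⊕ u⊖u′ v⊖v′) ⟫

    ∼-· : ∀ a {u v} → u ∼ v → a · u ∼ a · v
    ∼-· a {u} {v} ⟪ u⊖v ⟫ = ⟪ InSpan-resp (·-distrib-⊖ a u v) (InSpan-· a u⊖v) ⟫

    InSpan⇒∼[] : ∀ {u} → InSpan u → u ∼ []
    InSpan⇒∼[] {u} u∈ = ⟪ InSpan-resp (⊕-identityʳ u) u∈ ⟫

    ∼[]⇒InSpan : ∀ {u} → u ∼ [] → InSpan u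
    ∼[]⇒InSpan {u} ⟪ u∈ ⟫ = InSpan-resp (≋-sym (⊕-identityʳ u)) u∈

    ∼-lin : ∀ {Z : Set} {f g : Z → Free X} → (∀ z → f z ∼ g z) → ∀ u → lin f u ∼ lin g u
    ∼-lin {f = f} {g} f∼g u =
      ⟪ InSpan-resp (≋-sym (lin-⊖ᶠ f g u)) (InSpan-lin _ (⊖-InSpan ∘ f∼g) u) ⟫

    concatMap-∼ : ∀ {Z Z′ : Set} {f : Z → Free X} {g : Z′ → Free X} {L L′} →
      Pointwise (λ z z′ → f z ∼ g z′) L L′ → concatMap f L ∼ concatMap g L′
    concatMap-∼ [] = ∼-refl
    concatMap-∼ (r ∷ rs) = ∼-⊕ r (concatMap-∼ rs)

    ∼-setoid : Setoid c (c ⊔ ℓ)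
    ∼-setoid = record
      { Carrier = Free X ; _≈_ = _∼_
      ; isEquivalence = record { refl = ∼-refl ; sym = ∼-sym ; trans = ∼-trans } }

    module ∼-Reasoning = Relation.Binary.Reasoning.Setoid ∼-setoid

    concatMap-∼ᶠ : ∀ {Z : Set} {f g : Z → Free X} → (∀ z → f z ∼ g z) → ∀ L →
      concatMap f L ∼ concatMap g L
    concatMap-∼ᶠ f∼g [] = ∼-refl
    concatMap-∼ᶠ f∼g (z ∷ L) = ∼-⊕ (f∼g z) (concatMap-∼ᶠ f∼g L)

    formalSum-∼ : ∀ {L L′} → Pointwise (λ x y → ⟦ x ⟧ ∼ ⟦ y ⟧) L L′ → formalSum L ∼ formalSum L′
    formalSum-∼ [] = ∼-refl
    formalSum-∼ (r ∷ rs) = ∼-⊕ r (formalSum-∼ rs)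

  module _ {X Y G H : Set} (_≟X_ : DecidableEquality X) (_≟Y_ : DecidableEquality Y)
           (genX : G → Free X) (genY : H → Free Y) where

    private
      module SX = Span _≟X_ genX
      module SY = Span _≟Y_ genY
      open Coordinates _≟Y_ using (≋-trans)
      open LinearMaps _≟Y_ using (lin-∘)

    lin-InSpan : ∀ (f : X → Free Y) → (∀ g → SY.InSpan (lin f (genX g))) →
      ∀ {u} → SX.InSpan u → SY.InSpan (lin f u)
    lin-InSpan f f[gen]∈ (gs , u≋) =
      SY.InSpan-resp (≋-trans (lin-resp _≟X_ _≟Y_ f u≋) (lin-∘ f genX gs)) (SY.InSpan-lin _ f[gen]∈ gs)

module QuotientBialgebra {c ℓ} (F : Field c ℓ) where

  open Field F
  open Over F
  open FreeSpace F
  open Coordinates _≟B_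
  open LinearMaps _≟B_
  open Span _≟B_ genVec
  open Lists
    using (sh-[]ʳ; length-sh; sh-assoc; splits; initSplits; splits≡initSplits∷ʳ; ++-∈-initSplits;
           length-proj₁-∈-initSplits; length-proj₂-∈-splits; splits₃ˡ; splits₃ʳ; splits₃ˡ↭splits₃ʳ;
           concatMap-↭; concatMap-concatMap; concatMap-cong-∈)
  open Flattening using (fl-shift)
  open Patterns
    using (lettersB; _≅_; deg-≅; letters-↑ˡ; letters-↑ʳ; initSplits-≅; ΔB-≅; ΔB≡splits; shB-≅;
           letters-shB-shBˡ; letters-shB-shBʳ)
  open import Data.Nat as ℕ using (ℕ; zero; suc; _≤_; s≤s)
  import Data.Nat.Properties as ℕP
  open import Data.Fin using (Fin; _↑ˡ_; _↑ʳ_)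
  open import Data.List using (List; []; _∷_; _++_; [_]; map; concatMap; length)
  import Data.List.Properties as ListP
  open import Data.List.Membership.Propositional using (_∈_)
  open import Data.List.Relation.Unary.All as All using (All; []; _∷_)
  import Data.List.Relation.Unary.All.Properties as All
  open import Data.List.Relation.Unary.Any using (here; there)
  import Data.List.Relation.Binary.Pointwise as Pointwise
  open import Data.List.Relation.Binary.Permutation.Propositional using (_↭_; ↭-sym)
  import Data.List.Relation.Binary.Permutation.Propositional.Properties as PermP
  open import Data.Product as Product using (_×_; _,_; proj₁; proj₂; map₁)
  open import Data.Sum using (_⊎_; inj₁; inj₂)
  open import Data.Empty using (⊥-elim)
  open import Function using (_∘_)
  open import Relation.Nullary using (yes; no)
  import Relation.Binary.PropositionalEquality as ≡

  InI⇒∼[] : ∀ u → InI u → u ∼ []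
  InI⇒∼[] u (gs , u≈) = InSpan⇒∼[] (gs , mk≋ u≈)

  InSpan⇒InI : ∀ {u} → InSpan u → InI u
  InSpan⇒InI (gs , u≋) = gs , coeff-≈ u≋

  ∼[]⇒InI : ∀ {u} → u ∼ [] → InI u
  ∼[]⇒InI = InSpan⇒InI ∘ ∼[]⇒InSpan

  ≅⇒∼ : ∀ {x y} → x ≅ y → ⟦ x ⟧ ∼ ⟦ y ⟧
  ≅⇒∼ {x} {y} x≅y = ⟪ InSpan-gen ((x , y) , x≅y) ⟫

  lin-∼ : ∀ {f : Basis → W} → (∀ {x y} → x ≅ y → f x ∼ f y) → ∀ {u v} → u ∼ v → lin f u ∼ lin f v
  lin-∼ {f} f-resp {u} {v} ⟪ u⊖v ⟫ =
    ⟪ InSpan-resp (≋-sym (lin-⊖ f u v)) (lin-InSpan _≟B_ _≟B_ genVec genVec f f[gen]∈ u⊖v) ⟫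
    where
    f[gen]∈ : ∀ g → InSpan (lin f (genVec g))
    f[gen]∈ ((x , y) , x≅y) =
      InSpan-resp (≋-trans (lin-⊖ f ⟦ x ⟧ ⟦ y ⟧) (⊖-cong (lin-⟦⟧ f x) (lin-⟦⟧ f y))) (⊖-InSpan (f-resp x≅y))

  component : ℕ → Basis → W
  component d x with deg x ℕ.≟ d
  ... | yes _ = ⟦ x ⟧
  ... | no _ = []

  proj≋lin-component : ∀ d u → proj d u ≋ lin (component d) u
  proj≋lin-component d [] = ≋-refl
  proj≋lin-component d ((a , x) ∷ u) with deg x ℕ.≟ d
  ... | yes dx = ≋-trans (≋-reflexive (ListP.filter-accept _ {x = a , x} {xs = u} dx))
                         (≋-trans (∷≋·⟦⟧⊕ a x (proj d u)) (⊕-cong ≋-refl (proj≋lin-component d u)))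
  ... | no ¬dx = ≋-trans (≋-reflexive (ListP.filter-reject _ {x = a , x} {xs = u} ¬dx))
                         (proj≋lin-component d u)

  component-∼ : ∀ d {x y} → x ≅ y → component d x ∼ component d y
  component-∼ d {x} {y} x≅y with deg x ℕ.≟ d | deg y ℕ.≟ d
  ... | yes _ | yes _ = ≅⇒∼ x≅y
  ... | no _ | no _ = ∼-refl
  ... | yes dx | no ¬dy = ⊥-elim (¬dy (≡.trans (≡.sym (deg-≅ x≅y)) dx))
  ... | no ¬dx | yes dy = ⊥-elim (¬dx (≡.trans (deg-≅ x≅y) dy))

  homogeneous : IsHomogeneous
  homogeneous u u∈I d =
    ∼[]⇒InI (∼-resp (proj≋lin-component d u) ≋-refl (lin-∼ (component-∼ d) (InI⇒∼[] u u∈I)))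

  prodB : Basis → Basis → W
  prodB x y = formalSum (shB x y)

  ∙-congˡ : ∀ {u u′} v → u ≋ u′ → u ∙ v ≋ u′ ∙ v
  ∙-congˡ v = lin-resp _≟B_ _≟B_ (λ x → lin (prodB x) v)

  ∙-congʳ : ∀ u {v v′} → v ≋ v′ → u ∙ v ≋ u ∙ v′
  ∙-congʳ u v≋v′ = lin-cong (λ x → lin-resp _≟B_ _≟B_ (prodB x) v≋v′) u

  ∙-zeroʳ : ∀ u → u ∙ [] ≡.≡ []
  ∙-zeroʳ [] = ≡.refl
  ∙-zeroʳ (_ ∷ u) = ∙-zeroʳ u

  ⟦⟧∙ : ∀ x v → ⟦ x ⟧ ∙ v ≋ lin (prodB x) v
  ⟦⟧∙ x v = lin-⟦⟧ (λ x → lin (prodB x) v) x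

  ⟦⟧∙⟦⟧ : ∀ x y → ⟦ x ⟧ ∙ ⟦ y ⟧ ≋ prodB x y
  ⟦⟧∙⟦⟧ x y = ≋-trans (⟦⟧∙ x ⟦ y ⟧) (lin-⟦⟧ (prodB x) y)

  ∙-linˡ : ∀ {X : Set} (G : X → W) L v → lin G L ∙ v ≋ lin (λ l → G l ∙ v) L
  ∙-linˡ G L v = lin-∘ (λ x → lin (prodB x) v) G L

  ∙-linʳ : ∀ {X : Set} (G : X → W) L u → u ∙ lin G L ≋ lin (λ l → u ∙ G l) L
  ∙-linʳ G L u = ≋-trans (lin-cong (λ x → lin-∘ (prodB x) G L) u) (lin-comm (λ x l → lin (prodB x) (G l)) u L)

  ∙≋lin-⟦⟧∙ : ∀ u v → u ∙ v ≋ lin (λ x → ⟦ x ⟧ ∙ v) u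
  ∙≋lin-⟦⟧∙ u v = lin-cong (λ x → ≋-sym (⟦⟧∙ x v)) u

  ∙≋lin-∙⟦⟧ : ∀ u v → u ∙ v ≋ lin (λ y → u ∙ ⟦ y ⟧) v
  ∙≋lin-∙⟦⟧ u v = ≋-trans (∙-congʳ u (≋-sym (lin-id v))) (∙-linʳ ⟦_⟧ v u)

  ∙-concatMapˡ : ∀ {X : Set} (G : X → W) L v → concatMap G L ∙ v ≋ concatMap (λ l → G l ∙ v) L
  ∙-concatMapˡ G L v =
    ≋-trans (∙-congˡ v (≋-sym (lin-formalSum G L))) (≋-trans (∙-linˡ G (formalSum L) v) (lin-formalSum _ L))

  ∙-concatMapʳ : ∀ {X : Set} (G : X → W) L u → u ∙ concatMap G L ≋ concatMap (λ l → u ∙ G l) L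
  ∙-concatMapʳ G L u =
    ≋-trans (∙-congʳ u (≋-sym (lin-formalSum G L))) (≋-trans (∙-linʳ G (formalSum L) u) (lin-formalSum _ L))

  ∙-∼ : ∀ {u u′ v v′} → u ∼ u′ → v ∼ v′ → u ∙ v ∼ u′ ∙ v′
  ∙-∼ {u} {u′} {v} {v′} u∼u′ v∼v′ = ∼-trans
    (lin-∼ (λ {x} {y} x≅y → ∼-lin (λ z → formalSum-∼ (shB-∼ {x} {y} {z} x≅y ≡.refl)) v) u∼u′)
    (∼-lin (λ x → lin-∼ (λ {y} {z} y≅z → formalSum-∼ (shB-∼ {x} {x} {y} {z} ≡.refl y≅z)) v∼v′) u′)
    where
    shB-∼ : ∀ {x x′ z z′} → x ≅ x′ → z ≅ z′ → Pointwise.Pointwise (λ s s′ → ⟦ s ⟧ ∼ ⟦ s′ ⟧) (shB x z) (shB x′ z′)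
    shB-∼ x≅x′ z≅z′ = Pointwise.map ≅⇒∼ (shB-≅ x≅x′ z≅z′)

  ideal : IsTwoSidedIdeal
  ideal u v u∈I = ∼[]⇒InI (∙-∼ (InI⇒∼[] u u∈I) (∼-refl {v})) ,
                  ∼[]⇒InI (∼-trans (∙-∼ (∼-refl {v}) (InI⇒∼[] u u∈I)) (≋⇒∼ (≋-reflexive (∙-zeroʳ v))))

  εB-≅ : ∀ {x y} → x ≅ y → εB x ≡.≡ εB y
  εB-≅ {_ , []} {_ , []} _ = ≡.refl
  εB-≅ {_ , _ ∷ _} {_ , _ ∷ _} _ = ≡.refl
  εB-≅ {m , []} {n , b ∷ w} x≅y with () ← deg-≅ {m , []} {n , b ∷ w} x≅y
  εB-≅ {m , a ∷ v} {n , []} x≅y with () ← deg-≅ {m , a ∷ v} {n , []} x≅y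

  ε≈eval-εB : ∀ u → ε u ≈ eval εB u
  ε≈eval-εB [] = refl
  ε≈eval-εB ((a , x) ∷ u) = +-congˡ (ε≈eval-εB u)

  ε-I : ∀ u → InI u → ε u ≈ 0#
  ε-I u (gs , u≈) = begin
    ε u                          ≈⟨ ε≈eval-εB u ⟩
    eval εB u                    ≈⟨ eval-resp εB (mk≋ {u} {lin genVec gs} u≈) ⟩
    eval εB (lin genVec gs)      ≈⟨ eval-lin εB genVec gs ⟩
    eval (eval εB ∘ genVec) gs   ≈⟨ eval-zero _ εB[gen]≈0 gs ⟩
    0#                           ∎
    where
    open import Relation.Binary.Reasoning.Setoid setoid
    εB[gen]≈0 : ∀ g → eval εB (genVec g) ≈ 0#
    εB[gen]≈0 ((x , y) , x≅y) = begin
      eval εB (⟦ x ⟧ ⊖ ⟦ y ⟧)  ≈⟨ trans (eval-⊖ εB ⟦ x ⟧ ⟦ y ⟧) (+-cong (eval-⟦⟧ εB x) (-‿cong (eval-⟦⟧ εB y))) ⟩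
      εB x - εB y             ≈⟨ +-congˡ (-‿cong (reflexive (≡.sym (εB-≅ x≅y)))) ⟩
      εB x - εB x             ≈⟨ -‿inverseʳ (εB x) ⟩
      0#                      ∎

  pair : Basis → Basis → W⊗W
  pair x y = ⟦ (x , y) ⟧

  _⊗_ : W → W → W⊗W
  u ⊗ v = bilin pair u v

  TensorGen : Set
  TensorGen = (Gen × Basis) ⊎ (Basis × Gen)

  tensorGen : TensorGen → W⊗W
  tensorGen (inj₁ (g , y)) = genVec g ⊗ ⟦ y ⟧
  tensorGen (inj₂ (x , g)) = ⟦ x ⟧ ⊗ genVec g

  module T where
    open Coordinates _≟B²_ public
    open LinearMaps _≟B²_ public
    open Span _≟B²_ tensorGen public

  private
    splitGens : Free TensorGen → Free (Gen × Basis) × Free (Basis × Gen)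
    splitGens [] = [] , []
    splitGens ((a , inj₁ p) ∷ gs) = Product.map₁ ((a , p) ∷_) (splitGens gs)
    splitGens ((a , inj₂ p) ∷ gs) = Product.map₂ ((a , p) ∷_) (splitGens gs)

    lin-splitGens : ∀ gs → lin tensorGen gs T.≋
      lin (tensorGen ∘ inj₁) (proj₁ (splitGens gs)) ⊕ lin (tensorGen ∘ inj₂) (proj₂ (splitGens gs))
    lin-splitGens [] = T.≋-refl
    lin-splitGens ((a , inj₁ p) ∷ gs) = T.≋-trans (T.⊕-cong T.≋-refl (lin-splitGens gs))
      (T.≋-reflexive (≡.sym (ListP.++-assoc (a · tensorGen (inj₁ p)) (lin (tensorGen ∘ inj₁) ls) (lin (tensorGen ∘ inj₂) rs))))
      where
      ls = proj₁ (splitGens gs)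
      rs = proj₂ (splitGens gs)
    lin-splitGens ((a , inj₂ p) ∷ gs) = T.≋-trans (T.⊕-cong T.≋-refl (lin-splitGens gs))
      (T.↭⇒≋ (PermP.shifts (a · tensorGen (inj₂ p)) (lin (tensorGen ∘ inj₁) (proj₁ (splitGens gs)))))

  T-InSpan⇒InI⊗W+W⊗I : ∀ {t} → T.InSpan t → InI⊗W+W⊗I t
  T-InSpan⇒InI⊗W+W⊗I (gs , t≋) =
    proj₁ (splitGens gs) , proj₂ (splitGens gs) , T.coeff-≈ (T.≋-trans t≋ (lin-splitGens gs))

  ⟦⟧⊗⟦⟧ : ∀ x y → ⟦ x ⟧ ⊗ ⟦ y ⟧ T.≋ ⟦ (x , y) ⟧
  ⟦⟧⊗⟦⟧ x y = T.≋-trans (T.lin-⟦⟧ (λ x′ → lin (pair x′) ⟦ y ⟧) x) (T.lin-⟦⟧ (pair x) y)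

  ⟦⟧⊗⟦⟧-∼ : ∀ {x x′ y y′} → x ≅ x′ → y ≅ y′ → ⟦ (x , y) ⟧ T.∼ ⟦ (x′ , y′) ⟧
  ⟦⟧⊗⟦⟧-∼ {x} {x′} {y} {y′} x≅x′ y≅y′ = T.∼-trans
    T.⟪ T.InSpan-resp left≋ (T.InSpan-gen (inj₁ (((x , x′) , x≅x′) , y))) ⟫
    T.⟪ T.InSpan-resp right≋ (T.InSpan-gen (inj₂ (x′ , ((y , y′) , y≅y′)))) ⟫
    where
    left≋ : ⟦ (x , y) ⟧ ⊖ ⟦ (x′ , y) ⟧ T.≋ (⟦ x ⟧ ⊖ ⟦ x′ ⟧) ⊗ ⟦ y ⟧
    left≋ = T.≋-sym (T.≋-trans (T.lin-⊖ (λ x″ → lin (pair x″) ⟦ y ⟧) ⟦ x ⟧ ⟦ x′ ⟧)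
                               (T.⊖-cong (⟦⟧⊗⟦⟧ x y) (⟦⟧⊗⟦⟧ x′ y)))
    right≋ : ⟦ (x′ , y) ⟧ ⊖ ⟦ (x′ , y′) ⟧ T.≋ ⟦ x′ ⟧ ⊗ (⟦ y ⟧ ⊖ ⟦ y′ ⟧)
    right≋ = T.≋-sym (T.≋-trans (T.lin-⟦⟧ (λ x″ → lin (pair x″) (⟦ y ⟧ ⊖ ⟦ y′ ⟧)) x′)
                      (T.≋-trans (T.lin-⊖ (pair x′) ⟦ y ⟧ ⟦ y′ ⟧)
                                 (T.⊖-cong (T.lin-⟦⟧ (pair x′) y) (T.lin-⟦⟧ (pair x′) y′))))

  coprodB : Basis → W⊗W
  coprodB x = formalSum (ΔB x)

  coideal : IsCoideal
  coideal u u∈I =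
    T-InSpan⇒InI⊗W+W⊗I (lin-InSpan _≟B_ _≟B²_ genVec tensorGen coprodB Δ[gen]∈ (∼[]⇒InSpan {u} (InI⇒∼[] u u∈I))) ,
    ε-I u u∈I
    where
    Δ[gen]∈ : ∀ g → T.InSpan (Δ (genVec g))
    Δ[gen]∈ ((x , y) , x≅y) =
      T.InSpan-resp (T.≋-trans (T.lin-⊖ coprodB ⟦ x ⟧ ⟦ y ⟧) (T.⊖-cong (T.lin-⟦⟧ coprodB x) (T.lin-⟦⟧ coprodB y)))
        (T.⊖-InSpan (T.formalSum-∼ (Pointwise.map (λ (p≅ , q≅) → ⟦⟧⊗⟦⟧-∼ p≅ q≅) (ΔB-≅ x≅y))))

  formalSum-↭-letters : ∀ L L′ → map lettersB L ↭ map lettersB L′ → formalSum L ∼ formalSum L′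
  formalSum-↭-letters L L′ p with PermP.↭-map-inv lettersB p
  ... | L″ , L′≡L″ , L↭L″ = ∼-trans (≋⇒∼ (↭⇒≋ (PermP.map⁺ (λ x → 1# , x) L↭L″)))
    (formalSum-∼ (Pointwise.map (≅⇒∼ ∘ ≡.cong fl)
      (Pointwise.map⁻ lettersB lettersB (Pointwise.≡⇒Pointwise-≡ (≡.sym L′≡L″)))))

  formalSum-∙ : ∀ L v → formalSum L ∙ v ≋ concatMap (λ b → ⟦ b ⟧ ∙ v) L
  formalSum-∙ L v = ≋-trans (∙≋lin-⟦⟧∙ (formalSum L) v) (lin-formalSum _ L)

  ∙-formalSum : ∀ L u → u ∙ formalSum L ≋ concatMap (λ b → u ∙ ⟦ b ⟧) L
  ∙-formalSum L u = ≋-trans (∙≋lin-∙⟦⟧ u (formalSum L)) (lin-formalSum _ L)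

  ⟦⟧-assoc : ∀ x y z → (⟦ x ⟧ ∙ ⟦ y ⟧) ∙ ⟦ z ⟧ ∼ ⟦ x ⟧ ∙ (⟦ y ⟧ ∙ ⟦ z ⟧)
  ⟦⟧-assoc x y z = ∼-resp lhs≋ rhs≋ (formalSum-↭-letters _ _
    (≡.subst₂ _↭_ (≡.sym (letters-shB-shBˡ x y z)) (≡.sym (letters-shB-shBʳ x y z))
      (sh-assoc (lettersB x) (map (proj₁ x ℕ.+_) (lettersB y)) (map ((proj₁ x ℕ.+ proj₁ y) ℕ.+_) (lettersB z)))))
    where
    lhs≋ : (⟦ x ⟧ ∙ ⟦ y ⟧) ∙ ⟦ z ⟧ ≋ formalSum (concatMap (λ b → shB b z) (shB x y))
    lhs≋ = ≋-trans (∙-congˡ ⟦ z ⟧ (⟦⟧∙⟦⟧ x y)) (≋-trans (formalSum-∙ (shB x y) ⟦ z ⟧)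
      (≋-trans (concatMap-≋ (λ b → ⟦⟧∙⟦⟧ b z) (shB x y))
               (≋-reflexive (≡.sym (ListP.map-concatMap (λ x → 1# , x) (λ b → shB b z) (shB x y))))))
    rhs≋ : ⟦ x ⟧ ∙ (⟦ y ⟧ ∙ ⟦ z ⟧) ≋ formalSum (concatMap (shB x) (shB y z))
    rhs≋ = ≋-trans (∙-congʳ ⟦ x ⟧ (⟦⟧∙⟦⟧ y z)) (≋-trans (∙-formalSum (shB y z) ⟦ x ⟧)
      (≋-trans (concatMap-≋ (⟦⟧∙⟦⟧ x) (shB y z))
               (≋-reflexive (≡.sym (ListP.map-concatMap (λ x → 1# , x) (shB x) (shB y z))))))

  -- Associativity is trilinear, so it is reduced to basis vectors one argument at a time.
  ∙-assoc : ∀ u v w → (u ∙ v) ∙ w ∼ u ∙ (v ∙ w)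
  ∙-assoc u v w = ∼-resp
    (≋-trans (∙-congˡ w (∙≋lin-⟦⟧∙ u v)) (∙-linˡ (λ x → ⟦ x ⟧ ∙ v) u w))
    (∙≋lin-⟦⟧∙ u (v ∙ w))
    (∼-lin (λ x → ⟦⟧∙-assoc x v w) u)
    where
    ⟦⟧⟦⟧∙-assoc : ∀ x y w → (⟦ x ⟧ ∙ ⟦ y ⟧) ∙ w ∼ ⟦ x ⟧ ∙ (⟦ y ⟧ ∙ w)
    ⟦⟧⟦⟧∙-assoc x y w = ∼-resp
      (∙≋lin-∙⟦⟧ (⟦ x ⟧ ∙ ⟦ y ⟧) w)
      (≋-trans (∙-congʳ ⟦ x ⟧ (∙≋lin-∙⟦⟧ ⟦ y ⟧ w)) (∙-linʳ (λ z → ⟦ y ⟧ ∙ ⟦ z ⟧) w ⟦ x ⟧))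
      (∼-lin (⟦⟧-assoc x y) w)
    ⟦⟧∙-assoc : ∀ x v w → (⟦ x ⟧ ∙ v) ∙ w ∼ ⟦ x ⟧ ∙ (v ∙ w)
    ⟦⟧∙-assoc x v w = ∼-resp
      (≋-trans (∙-congˡ w (∙≋lin-∙⟦⟧ ⟦ x ⟧ v)) (∙-linˡ (λ y → ⟦ x ⟧ ∙ ⟦ y ⟧) v w))
      (≋-trans (∙-congʳ ⟦ x ⟧ (∙≋lin-⟦⟧∙ v w)) (∙-linʳ (λ y → ⟦ y ⟧ ∙ w) v ⟦ x ⟧))
      (∼-lin (λ y → ⟦⟧⟦⟧∙-assoc x y w) v)

  ⟦∅⟧∙ : ∀ k u → ⟦ (k , []) ⟧ ∙ u ∼ u
  ⟦∅⟧∙ k u = ∼-resp (∙≋lin-∙⟦⟧ ⟦ (k , []) ⟧ u) (≋-sym (lin-id u)) (∼-lin ⟦∅⟧∙⟦⟧ u)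
    where
    ⟦∅⟧∙⟦⟧ : ∀ y → ⟦ (k , []) ⟧ ∙ ⟦ y ⟧ ∼ ⟦ y ⟧
    ⟦∅⟧∙⟦⟧ (n , w) = ∼-trans (≋⇒∼ (⟦⟧∙⟦⟧ (k , []) (n , w)))
      (≅⇒∼ (≡.trans (≡.cong fl (letters-↑ʳ k w)) (fl-shift k (letters w))))

  ∙⟦∅⟧ : ∀ k u → u ∙ ⟦ (k , []) ⟧ ∼ u
  ∙⟦∅⟧ k u = ∼-resp (∙≋lin-⟦⟧∙ u ⟦ (k , []) ⟧) (≋-sym (lin-id u)) (∼-lin ⟦⟧∙⟦∅⟧ u)
    where
    ⟦⟧∙⟦∅⟧ : ∀ x → ⟦ x ⟧ ∙ ⟦ (k , []) ⟧ ∼ ⟦ x ⟧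
    ⟦⟧∙⟦∅⟧ (m , v) = ∼-trans (≋⇒∼ (≋-trans (⟦⟧∙⟦⟧ (m , v) (k , []))
        (≋-reflexive (≡.cong (formalSum ∘ map (λ u → m ℕ.+ k , u)) (sh-[]ʳ (map (_↑ˡ k) v))))))
      (≅⇒∼ (≡.cong fl (letters-↑ˡ v k)))

  multB : Basis × Basis → W
  multB p = ⟦ proj₁ p ⟧ ∙ ⟦ proj₂ p ⟧

  mult-⊗ : ∀ u v → mult (u ⊗ v) ≋ u ∙ v
  mult-⊗ u v = begin
    mult (lin (λ a → lin (pair a) v) u)
      ≈⟨ lin-∘ multB (λ a → lin (pair a) v) u ⟩
    lin (λ a → mult (lin (pair a) v)) u
      ≈⟨ lin-cong (λ a → ≋-trans (lin-∘ multB (pair a) v) (lin-cong (λ b → lin-⟦⟧ multB (a , b)) v)) u ⟩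
    lin (λ a → lin (λ b → ⟦ a ⟧ ∙ ⟦ b ⟧) v) u
      ≈⟨ lin-cong (λ a → ∙≋lin-∙⟦⟧ ⟦ a ⟧ v) u ⟨
    lin (λ a → ⟦ a ⟧ ∙ v) u
      ≈⟨ ∙≋lin-⟦⟧∙ u v ⟨
    u ∙ v ∎
    where open ≋-Reasoning

  infixl 7 _⋆_
  _⋆_ : (Basis → W) → (Basis → W) → Basis → W
  (f ⋆ g) (n , w) = concatMap (λ pq → f (n , proj₁ pq) ∙ g (n , proj₂ pq)) (splits w)

  mult-⊗map-Δ : ∀ f g x → mult ((f ⊗map g) (Δ ⟦ x ⟧)) ≋ (f ⋆ g) x
  mult-⊗map-Δ f g (n , w) = begin
    mult ((f ⊗map g) (Δ ⟦ (n , w) ⟧))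
      ≈⟨ lin-resp _≟B²_ _≟B_ multB (lin-resp _≟B²_ _≟B²_ f⊗g (T.lin-⟦⟧ coprodB (n , w))) ⟩
    mult ((f ⊗map g) (coprodB (n , w)))
      ≈⟨ lin-resp _≟B²_ _≟B_ multB (T.lin-formalSum f⊗g (ΔB (n , w))) ⟩
    mult (concatMap f⊗g (ΔB (n , w)))
      ≡⟨ lin-concatMap multB f⊗g (ΔB (n , w)) ⟩
    concatMap (mult ∘ f⊗g) (ΔB (n , w))
      ≈⟨ concatMap-≋ (λ p → mult-⊗ (f (proj₁ p)) (g (proj₂ p))) (ΔB (n , w)) ⟩
    concatMap (λ p → f (proj₁ p) ∙ g (proj₂ p)) (ΔB (n , w))
      ≡⟨ ≡.trans (≡.cong (concatMap (λ p → f (proj₁ p) ∙ g (proj₂ p))) (ΔB≡splits n w))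
                 (ListP.concatMap-map _ _ (splits w)) ⟩
    (f ⋆ g) (n , w) ∎
    where
    open ≋-Reasoning
    f⊗g : Basis × Basis → W⊗W
    f⊗g p = f (proj₁ p) ⊗ g (proj₂ p)

  ⋆-∼ : ∀ {f f′ g g′} → (∀ x → f x ∼ f′ x) → (∀ x → g x ∼ g′ x) → ∀ x → (f ⋆ g) x ∼ (f′ ⋆ g′) x
  ⋆-∼ f∼f′ g∼g′ (n , w) = concatMap-∼ᶠ (λ pq → ∙-∼ (f∼f′ (n , proj₁ pq)) (g∼g′ (n , proj₂ pq))) (splits w)

  ⋆-assoc : ∀ f g h x → ((f ⋆ g) ⋆ h) x ∼ (f ⋆ (g ⋆ h)) x
  ⋆-assoc f g h (n , w) = ∼-resp lhs≋ rhs≋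
    (∼-trans (concatMap-∼ᶠ (λ t → ∙-assoc (fₜ t) (gₜ t) (hₜ t)) (splits₃ʳ w))
             (≋⇒∼ (↭⇒≋ (concatMap-↭ (λ t → fₜ t ∙ (gₜ t ∙ hₜ t)) (↭-sym (splits₃ˡ↭splits₃ʳ w))))))
    where
    fₜ gₜ hₜ : List (Fin n) × List (Fin n) × List (Fin n) → W
    fₜ t = f (n , proj₁ t)
    gₜ t = g (n , proj₁ (proj₂ t))
    hₜ t = h (n , proj₂ (proj₂ t))
    lhs≋ : ((f ⋆ g) ⋆ h) (n , w) ≋ concatMap (λ t → (fₜ t ∙ gₜ t) ∙ hₜ t) (splits₃ʳ w)
    lhs≋ = ≋-trans
      (concatMap-≋ (λ tr → ∙-concatMapˡ (λ pq → f (n , proj₁ pq) ∙ g (n , proj₂ pq)) (splits (proj₁ tr)) (h (n , proj₂ tr)))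
                   (splits w))
      (≋-reflexive (≡.sym (≡.trans (concatMap-concatMap _ _ (splits w))
        (ListP.concatMap-cong (λ tr → ListP.concatMap-map _ _ (splits (proj₁ tr))) (splits w)))))
    rhs≋ : (f ⋆ (g ⋆ h)) (n , w) ≋ concatMap (λ t → fₜ t ∙ (gₜ t ∙ hₜ t)) (splits₃ˡ w)
    rhs≋ = ≋-trans
      (concatMap-≋ (λ ps → ∙-concatMapʳ (λ qr → g (n , proj₁ qr) ∙ h (n , proj₂ qr)) (splits (proj₂ ps)) (f (n , proj₁ ps)))
                   (splits w))
      (≋-reflexive (≡.sym (≡.trans (concatMap-concatMap _ _ (splits w))
        (ListP.concatMap-cong (λ ps → ListP.concatMap-map _ _ (splits (proj₂ ps))) (splits w)))))

  η : Basis → W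
  η x = εB x · 𝟙

  0#·𝟙≋[] : 0# · 𝟙 ≋ []
  0#·𝟙≋[] = mk≋ λ z → trans (coeff-· z 0# 𝟙) (zeroˡ _)

  1#·𝟙≋𝟙 : 1# · 𝟙 ≋ 𝟙
  1#·𝟙≋𝟙 = mk≋ λ z → trans (coeff-· z 1# 𝟙) (*-identityˡ _)

  ⋆-identityʳ : ∀ f x → (f ⋆ η) x ∼ f x
  ⋆-identityʳ f (n , w) = go (λ p → f (n , p)) w
    where
    go : ∀ (A : List (Fin n) → W) w → concatMap (λ pq → A (proj₁ pq) ∙ η (n , proj₂ pq)) (splits w) ∼ A w
    go A [] = ∼-trans (≋⇒∼ (≋-trans (⊕-identityʳ _) (∙-congʳ (A []) 1#·𝟙≋𝟙))) (∙⟦∅⟧ 0 (A []))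
    go A (a ∷ w) = ∼-trans
      (≋⇒∼ (⊕-cong (≋-trans (∙-congʳ (A []) 0#·𝟙≋[]) (≋-reflexive (∙-zeroʳ (A []))))
                   (≋-reflexive (ListP.concatMap-map _ (map₁ (a ∷_)) (splits w)))))
      (go (λ p → A (a ∷ p)) w)

  ⋆-identityˡ : ∀ g x → (η ⋆ g) x ∼ g x
  ⋆-identityˡ g (n , []) = ∼-trans
    (≋⇒∼ (≋-trans (⊕-identityʳ ((1# · 𝟙) ∙ g (n , []))) (∙-congˡ (g (n , [])) 1#·𝟙≋𝟙)))
    (⟦∅⟧∙ 0 (g (n , [])))
  ⋆-identityˡ g (n , a ∷ w) = ∼-trans
    (≋⇒∼ (≋-trans (⊕-cong (∙-congˡ (g (n , a ∷ w)) 1#·𝟙≋𝟙) rest≋[]) (⊕-identityʳ (𝟙 ∙ g (n , a ∷ w)))))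
    (⟦∅⟧∙ 0 (g (n , a ∷ w)))
    where
    rest≋[] : concatMap (λ pq → η (n , proj₁ pq) ∙ g (n , proj₂ pq)) (map (map₁ (a ∷_)) (splits w)) ≋ []
    rest≋[] = ≋-trans (≋-reflexive (ListP.concatMap-map _ (map₁ (a ∷_)) (splits w)))
                      (concatMap-≋[] (λ pq → ∙-congˡ (g (n , proj₂ pq)) 0#·𝟙≋[]) (splits w))

  -- The first argument is fuel; any bound on the length of the word gives the same value.
  leftAntipode : ℕ → ∀ n → List (Fin n) → W
  leftAntipode _ n [] = 𝟙
  leftAntipode zero n (_ ∷ _) = []
  leftAntipode (suc k) n (a ∷ w) =
    (- 1#) · concatMap (λ pq → leftAntipode k n (proj₁ pq) ∙ ⟦ (n , proj₂ pq) ⟧) (initSplits (a ∷ w))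

  rightAntipode : ℕ → ∀ n → List (Fin n) → W
  rightAntipode _ n [] = 𝟙
  rightAntipode zero n (_ ∷ _) = []
  rightAntipode (suc k) n (a ∷ w) =
    (- 1#) · concatMap (λ pq → ⟦ (n , a ∷ proj₁ pq) ⟧ ∙ rightAntipode k n (proj₂ pq)) (splits w)

  Sˡ Sʳ : Basis → W
  Sˡ (n , w) = leftAntipode (length w) n w
  Sʳ (n , w) = rightAntipode (length w) n w

  leftAntipode-fuel : ∀ n {k k′} w → length w ≤ k → length w ≤ k′ →
    leftAntipode k n w ≡.≡ leftAntipode k′ n w
  leftAntipode-fuel n [] _ _ = ≡.refl
  leftAntipode-fuel n {suc k} {suc k′} (a ∷ w) (s≤s w≤k) (s≤s w≤k′) =
    ≡.cong ((- 1#) ·_) (concatMap-cong-∈ (initSplits (a ∷ w)) λ {pq} pq∈ →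
      ≡.cong (_∙ ⟦ (n , proj₂ pq) ⟧) (leftAntipode-fuel n (proj₁ pq) (shorter pq∈ w≤k) (shorter pq∈ w≤k′)))
    where
    shorter : ∀ {pq j} → pq ∈ initSplits (a ∷ w) → length w ≤ j → length (proj₁ pq) ≤ j
    shorter pq∈ w≤j = ℕP.≤-trans (ℕP.≤-pred (length-proj₁-∈-initSplits (a ∷ w) pq∈)) w≤j

  rightAntipode-fuel : ∀ n {k k′} w → length w ≤ k → length w ≤ k′ →
    rightAntipode k n w ≡.≡ rightAntipode k′ n w
  rightAntipode-fuel n [] _ _ = ≡.refl
  rightAntipode-fuel n {suc k} {suc k′} (a ∷ w) (s≤s w≤k) (s≤s w≤k′) =
    ≡.cong ((- 1#) ·_) (concatMap-cong-∈ (splits w) λ {pq} pq∈ →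
      ≡.cong (⟦ (n , a ∷ proj₁ pq) ⟧ ∙_) (rightAntipode-fuel n (proj₂ pq)
        (ℕP.≤-trans (length-proj₂-∈-splits w pq∈) w≤k) (ℕP.≤-trans (length-proj₂-∈-splits w pq∈) w≤k′)))

  Sˡ-∷ : ∀ n a w →
    Sˡ (n , a ∷ w) ≡.≡ (- 1#) · concatMap (λ pq → Sˡ (n , proj₁ pq) ∙ ⟦ (n , proj₂ pq) ⟧) (initSplits (a ∷ w))
  Sˡ-∷ n a w = ≡.cong ((- 1#) ·_) (concatMap-cong-∈ (initSplits (a ∷ w)) λ {pq} pq∈ →
    ≡.cong (_∙ ⟦ (n , proj₂ pq) ⟧)
      (leftAntipode-fuel n (proj₁ pq) (ℕP.≤-pred (length-proj₁-∈-initSplits (a ∷ w) pq∈)) ℕP.≤-refl))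

  Sʳ-∷ : ∀ n a w →
    Sʳ (n , a ∷ w) ≡.≡ (- 1#) · concatMap (λ pq → ⟦ (n , a ∷ proj₁ pq) ⟧ ∙ Sʳ (n , proj₂ pq)) (splits w)
  Sʳ-∷ n a w = ≡.cong ((- 1#) ·_) (concatMap-cong-∈ (splits w) λ {pq} pq∈ →
    ≡.cong (⟦ (n , a ∷ proj₁ pq) ⟧ ∙_) (rightAntipode-fuel n (proj₂ pq) (length-proj₂-∈-splits w pq∈) ℕP.≤-refl))

  ⟦∅⟧∼η : ∀ n → ⟦ (n , []) ⟧ ∼ η (n , [])
  ⟦∅⟧∼η n = ∼-trans (≅⇒∼ ≡.refl) (≋⇒∼ (≋-sym 1#·𝟙≋𝟙))

  Sˡ⋆id : ∀ x → (Sˡ ⋆ ⟦_⟧) x ∼ η x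
  Sˡ⋆id (n , []) = ∼-trans (≋⇒∼ (⊕-identityʳ _)) (∼-trans (⟦∅⟧∙ 0 ⟦ (n , []) ⟧) (⟦∅⟧∼η n))
  Sˡ⋆id (n , a ∷ w) = ∼-resp split≋ 0#·𝟙≋[]
    (∼-trans (∼-⊕ (∼-refl {X}) (∼-trans (≋⇒∼ (⊕-identityʳ _))
                                         (∼-trans (∙⟦∅⟧ n (Sˡ (n , a ∷ w))) (≋⇒∼ (≋-reflexive (Sˡ-∷ n a w))))))
             (≋⇒∼ (⊖-self X)))
    where
    T : List (Fin n) × List (Fin n) → W
    T pq = Sˡ (n , proj₁ pq) ∙ ⟦ (n , proj₂ pq) ⟧
    X = concatMap T (initSplits (a ∷ w))
    split≋ : (Sˡ ⋆ ⟦_⟧) (n , a ∷ w) ≋ X ⊕ concatMap T [ (a ∷ w , []) ]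
    split≋ = ≋-reflexive (≡.trans (≡.cong (concatMap T) (splits≡initSplits∷ʳ (a ∷ w)))
                                 (ListP.concatMap-++ T (initSplits (a ∷ w)) [ (a ∷ w , []) ]))

  id⋆Sʳ : ∀ x → (⟦_⟧ ⋆ Sʳ) x ∼ η x
  id⋆Sʳ (n , []) = ∼-trans (≋⇒∼ (⊕-identityʳ _)) (∼-trans (∙⟦∅⟧ 0 ⟦ (n , []) ⟧) (⟦∅⟧∼η n))
  id⋆Sʳ (n , a ∷ w) = ∼-resp split≋ 0#·𝟙≋[]
    (∼-trans (∼-⊕ (∼-trans (⟦∅⟧∙ n (Sʳ (n , a ∷ w))) (≋⇒∼ (≋-reflexive (Sʳ-∷ n a w)))) (∼-refl {Y}))
             (≋⇒∼ (≋-trans (⊕-comm ((- 1#) · Y) Y) (⊖-self Y))))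
    where
    Y = concatMap (λ pq → ⟦ (n , a ∷ proj₁ pq) ⟧ ∙ Sʳ (n , proj₂ pq)) (splits w)
    split≋ : (⟦_⟧ ⋆ Sʳ) (n , a ∷ w) ≋ ⟦ (n , []) ⟧ ∙ Sʳ (n , a ∷ w) ⊕ Y
    split≋ = ≋-reflexive
      (≡.cong (⟦ (n , []) ⟧ ∙ Sʳ (n , a ∷ w) ++_) (ListP.concatMap-map _ (map₁ (a ∷_)) (splits w)))

  -- A left and a right inverse in the convolution monoid coincide.
  Sˡ∼Sʳ : ∀ x → Sˡ x ∼ Sʳ x
  Sˡ∼Sʳ x = begin
    Sˡ x                  ≈⟨ ⋆-identityʳ Sˡ x ⟨
    (Sˡ ⋆ η) x            ≈⟨ ⋆-∼ {f = Sˡ} {f′ = Sˡ} (λ _ → ∼-refl) (λ y → ∼-sym (id⋆Sʳ y)) x ⟩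
    (Sˡ ⋆ (⟦_⟧ ⋆ Sʳ)) x   ≈⟨ ⋆-assoc Sˡ ⟦_⟧ Sʳ x ⟨
    ((Sˡ ⋆ ⟦_⟧) ⋆ Sʳ) x   ≈⟨ ⋆-∼ {g = Sʳ} {g′ = Sʳ} Sˡ⋆id (λ _ → ∼-refl) x ⟩
    (η ⋆ Sʳ) x            ≈⟨ ⋆-identityˡ Sʳ x ⟩
    Sʳ x                  ∎
    where open ∼-Reasoning

  id⋆Sˡ : ∀ x → (⟦_⟧ ⋆ Sˡ) x ∼ η x
  id⋆Sˡ x = ∼-trans (⋆-∼ {f = ⟦_⟧} {f′ = ⟦_⟧} (λ _ → ∼-refl) Sˡ∼Sʳ x) (id⋆Sʳ x)

  -- No length hypothesis is needed: the fuel runs out at the same time on words of equal length.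
  leftAntipode-≅ : ∀ k {m n} {v : List (Fin m)} {w : List (Fin n)} → (m , v) ≅ (n , w) →
    leftAntipode k m v ∼ leftAntipode k n w
  leftAntipode-≅ k {v = []} {[]} _ = ∼-refl
  leftAntipode-≅ k {m} {n} {[]} {b ∷ w} v≅w with () ← deg-≅ {m , []} {n , b ∷ w} v≅w
  leftAntipode-≅ k {m} {n} {a ∷ v} {[]} v≅w with () ← deg-≅ {m , a ∷ v} {n , []} v≅w
  leftAntipode-≅ zero {v = _ ∷ _} {_ ∷ _} _ = ∼-refl
  leftAntipode-≅ (suc k) {v = _ ∷ _} {_ ∷ _} v≅w = ∼-· (- 1#)
    (concatMap-∼ (Pointwise.map (λ (p≅ , q≅) → ∙-∼ (leftAntipode-≅ k p≅) (≅⇒∼ q≅)) (initSplits-≅ v≅w)))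

  Sˡ-≅ : ∀ {x y} → x ≅ y → Sˡ x ∼ Sˡ y
  Sˡ-≅ {m , v} {n , w} v≅w = ≡.subst (λ k → leftAntipode (length v) m v ∼ leftAntipode k n w)
    (deg-≅ {m , v} {n , w} v≅w) (leftAntipode-≅ (length v) v≅w)

  HasDegree : ℕ → W → Set c
  HasDegree d u = All (λ p → deg (proj₂ p) ≡.≡ d) u

  HasDegree-· : ∀ {d} a u → HasDegree d u → HasDegree d (a · u)
  HasDegree-· a u = All.map⁺

  HasDegree-concatMap : ∀ {Z : Set} {d} {f : Z → W} L →
    (∀ {z} → z ∈ L → HasDegree d (f z)) → HasDegree d (concatMap f L)
  HasDegree-concatMap [] _ = []
  HasDegree-concatMap (z ∷ L) f-deg = All.++⁺ (f-deg (here ≡.refl)) (HasDegree-concatMap L (f-deg ∘ there))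

  HasDegree-lin : ∀ {d e} {f : Basis → W} → (∀ x → deg x ≡.≡ d → HasDegree e (f x)) →
    ∀ u → HasDegree d u → HasDegree e (lin f u)
  HasDegree-lin f-deg [] [] = []
  HasDegree-lin f-deg ((a , x) ∷ u) (dx ∷ du) = All.++⁺ (HasDegree-· a _ (f-deg x dx)) (HasDegree-lin f-deg u du)

  HasDegree-prodB : ∀ x y → HasDegree (deg x ℕ.+ deg y) (prodB x y)
  HasDegree-prodB (m , v) (n , w) = All.map⁺ (All.map⁺ (All.tabulate λ t∈ →
    ≡.trans (length-sh (map (_↑ˡ n) v) (map (m ↑ʳ_) w) t∈)
            (≡.cong₂ ℕ._+_ (ListP.length-map _ v) (ListP.length-map _ w))))

  HasDegree-∙ : ∀ {d e} u v → HasDegree d u → HasDegree e v → HasDegree (d ℕ.+ e) (u ∙ v)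
  HasDegree-∙ u v du dv = HasDegree-lin (λ x dx → HasDegree-lin (λ y ey →
    ≡.subst₂ (λ d e → HasDegree (d ℕ.+ e) (prodB x y)) dx ey (HasDegree-prodB x y)) v dv) u du

  leftAntipode-HasDegree : ∀ k n w → HasDegree (length w) (leftAntipode k n w)
  leftAntipode-HasDegree k n [] = ≡.refl ∷ []
  leftAntipode-HasDegree zero n (_ ∷ _) = []
  leftAntipode-HasDegree (suc k) n (a ∷ w) =
    HasDegree-· (- 1#) _ (HasDegree-concatMap (initSplits (a ∷ w)) λ {pq} pq∈ →
      ≡.subst (λ d → HasDegree d (leftAntipode k n (proj₁ pq) ∙ ⟦ (n , proj₂ pq) ⟧))
        (≡.trans (≡.sym (ListP.length-++ (proj₁ pq))) (≡.cong length (++-∈-initSplits (a ∷ w) pq∈)))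
        (HasDegree-∙ _ ⟦ (n , proj₂ pq) ⟧ (leftAntipode-HasDegree k n (proj₁ pq)) (≡.refl ∷ [])))

  antipode : QuotientHasGradedAntipode
  antipode = Sˡ , graded , preserves-I , left-inverse , right-inverse
    where
    graded : ∀ x → proj (deg x) (Sˡ x) ≈W Sˡ x
    graded (n , w) = coeff-≈ (≋-reflexive (ListP.filter-all _ (leftAntipode-HasDegree (length w) n w)))
    preserves-I : ∀ u → InI u → InI (lin Sˡ u)
    preserves-I u u∈I = ∼[]⇒InI (lin-∼ Sˡ-≅ (InI⇒∼[] u u∈I))
    left-inverse : ∀ x → InI (mult ((Sˡ ⊗map ⟦_⟧) (Δ ⟦ x ⟧)) ⊖ η x)
    left-inverse x = InSpan⇒InI (⊖-InSpan (∼-trans (≋⇒∼ (mult-⊗map-Δ Sˡ ⟦_⟧ x)) (Sˡ⋆id x)))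
    right-inverse : ∀ x → InI (mult ((⟦_⟧ ⊗map Sˡ) (Δ ⟦ x ⟧)) ⊖ η x)
    right-inverse x = InSpan⇒InI (⊖-InSpan (∼-trans (≋⇒∼ (mult-⊗map-Δ ⟦_⟧ Sˡ x)) (id⋆Sˡ x)))

proposition3p7 : ∀ {c ℓ} (F : Field c ℓ) → let open Over F in
    IsTwoSidedIdeal × IsCoideal × IsHomogeneous × QuotientHasGradedAntipode
proposition3p7 F = ideal , coideal , homogeneous , antipode
  where open QuotientBialgebra F
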